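{- Let $G_2$ be a genus of ternary integral quadratic forms such that every form $\tilde f\in G_2$ is equivalent over the $2$-adic integers $\mathbb Z_2$ to $4yz-x^2$. Let $n$ be a positive integer, written $n=4^a k$ with $4\nmid k$. Then \[ d_{G_2,2}(n)=\begin{cases} 3 & \text{if } k\equiv 7\pmod 8,\\ 3-\frac{1}{2^{a-1}} & \text{if } k\equiv 3\pmod 8,\\ 3-\frac{3}{2^{a}} & \text{if } k\equiv 1,2\pmod 4.\end{cases} \]
   Context: For a ternary form $\tilde f=ax^2+by^2+cz^2+dyz+ezx+fxy$ with integer coefficients, a prime $q$ and an integer $n$, the local ($q$-adic) representation density is $d_{\tilde f,q}(n)=q^{ -2t}\,\#\{(x,y,z)\in(\mathbb Z/q^t\mathbb Z)^3:\tilde f(x,y,z)\equiv n \pmod{q^t}\}$ for all sufficiently large $t$ (this quantity is eventually constant in $t$). It depends only on the $\mathbb Z_q$-equivalence class of $\tilde f$; for a genus $G$, $d_{G,q}(n)$ denotes $d_{\tilde f,q}(n)$ for any $\tilde f\in G$. -}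

module Defs where

open import Data.Nat as ℕ using (ℕ; zero; suc; _≤_; _^_)
open import Data.Nat.Divisibility as ℕD using (_∣?_)
open import Data.Integer as ℤ using (ℤ; +_; -_; _+_; _-_; _*_; ∣_∣)
open import Data.Integer.Divisibility as ℤD using ()
open import Data.Fin using (Fin; zero; suc)
open import Data.Product using (Σ; ∃; _×_; _,_)
open import Relation.Nullary using (¬_; does)
open import Data.Bool using (if_then_else_)
open import Relation.Binary.PropositionalEquality using (_≡_)

record TernaryForm : Set where
  constructor form
  field
    a b c d e f : ℤ

open TernaryForm public

eval : TernaryForm → ℤ → ℤ → ℤ → ℤ
eval Q x y z =
  a Q * x * x + b Q * y * y + c Q * z * z
  + d Q * y * z + e Q * z * x + f Q * x * y

target : TernaryForm
target = form (- + 1) (+ 0) (+ 0) (+ 4) (+ 0) (+ 0)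

Mat3 : Set
Mat3 = Fin 3 → Fin 3 → ℤ

sum3 : (Fin 3 → ℤ) → ℤ
sum3 g = g zero + g (suc zero) + g (suc (suc zero))

-- Gram matrix of Q doubled (integral): Q(v) = ½ vᵀ (gram Q) v.
gram : TernaryForm → Mat3
gram Q zero zero = + 2 * a Q
gram Q zero (suc zero) = f Q
gram Q zero (suc (suc zero)) = e Q
gram Q (suc zero) zero = f Q
gram Q (suc zero) (suc zero) = + 2 * b Q
gram Q (suc zero) (suc (suc zero)) = d Q
gram Q (suc (suc zero)) zero = e Q
gram Q (suc (suc zero)) (suc zero) = d Q
gram Q (suc (suc zero)) (suc (suc zero)) = + 2 * c Q

gramSubst : TernaryForm → Mat3 → Mat3
gramSubst Q M i j = sum3 (λ k → sum3 (λ l → M k i * gram Q k l * M l j))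

det3 : Mat3 → ℤ
det3 M =
    M zero zero * (M one one * M two two - M one two * M two one)
  - M zero one * (M one zero * M two two - M one two * M two zero)
  + M zero two * (M one zero * M two one - M one one * M two zero)
  where
  one two : Fin 3
  one = suc zero
  two = suc (suc zero)

-- Since GL₃(ℤ₂) is compact and
-- ℤ is dense in ℤ₂, Q ≅_{ℤ₂} R  iff  for every t there is an integer matrix
-- M with odd determinant (i.e. M ∈ GL₃(ℤ₂)) such that the coefficients of
-- Q(Mv) agree with those of R(v) modulo 2^t.  (Doubled Gram matrices are used;
-- quantifying over all t absorbs the factor 2.)
Z2Equiv : TernaryForm → TernaryForm → Set
Z2Equiv Q R =
  (t : ℕ) → Σ Mat3 λ M →
    (¬ (ℤD._∣_ (+ 2) (det3 M))) ×
    ((i j : Fin 3) → ℤD._∣_ (+ (2 ^ t)) (gramSubst Q M i j - gram R i j))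

sumBelow : ℕ → (ℕ → ℕ) → ℕ
sumBelow zero g = 0
sumBelow (suc N) g = sumBelow N g ℕ.+ g N

count2 : TernaryForm → ℤ → ℕ → ℕ
count2 Q n t =
  sumBelow N λ x → sumBelow N λ y → sumBelow N λ z →
    if does ((2 ^ t) ∣? ∣ eval Q (+ x) (+ y) (+ z) - n ∣) then 1 else 0
  where
  N : ℕ
  N = 2 ^ t

-- The 2-adic density d_{Q,2}(n) equals p / q  (q ≠ 0):
-- for all sufficiently large t,  2^{-2t} · count2 Q n t = p / q.
Density2Is : TernaryForm → ℤ → ℕ → ℕ → Set
Density2Is Q n p q =
  ∃ λ T → (t : ℕ) → T ≤ t → count2 Q n t ℕ.* q ≡ p ℕ.* 2 ^ (2 ℕ.* t)

{-# OPTIONS --safe #-}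

-- Over ℤ₂ the form F may be replaced by 4yz − x²: a matrix M of odd determinant with
-- Mᵀ·gram(F)·M ≡ gram(4yz − x²) (mod 2^(t+1)) gives F(Mv) ≡ 4yz − x² (mod 2^t), and v ↦ Mv is a
-- bijection of (ℤ/2^t)³ with inverse det(M)⁻¹·adj(M).
-- For 4yz − x² ≡ 4m the variable x is even, so the count modulo 2^(s+2) is 32 times the count of
-- yz − x² ≡ m modulo 2^s; splitting y and z by parity relates the latter back to 4yz − x², and the
-- density satisfies d(4m) = 3/2 + d(m)/2, whence d(4^a k) = 3 − (3 − d(k))/2^a. For 4 ∤ k:
-- −k is not a square modulo 4 if k ≡ 1, 2 (mod 4), so d(k) = 0; if k ≡ 3 (mod 8) then x is odd and
-- yz ≡ c (c odd) has 2^s solutions modulo 2^(s+1), so d(k) = 1; if k ≡ 7 (mod 8) then −k has an odd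
-- square root r modulo every 2^j, and completing the square reduces the count to that of
-- yz ≡ w(w + r), so d(k) = 3.
module Submission where

open import Defs

module Sums where

  open import Data.Nat using (ℕ; zero; suc; _+_; _*_; _<_; _≤_; _≟_)
  open import Data.Nat.Properties
  open import Data.Nat.Tactic.RingSolver using (solve-∀)
  open import Data.Bool using (if_then_else_)
  open import Function using (_∘_)
  open import Relation.Nullary using (does; yes; no)
  open import Relation.Nullary.Decidable using (dec-true; dec-false)
  open import Relation.Binary.PropositionalEquality
  open ≡-Reasoning

  sumBelow-cong< : ∀ N {f g : ℕ → ℕ} → (∀ i → i < N → f i ≡ g i) → sumBelow N f ≡ sumBelow N g
  sumBelow-cong< zero    eq = refl
  sumBelow-cong< (suc N) eq =
    cong₂ _+_ (sumBelow-cong< N (λ i i<N → eq i (m<n⇒m<1+n i<N))) (eq N (n<1+n N))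

  sumBelow-cong : ∀ N {f g : ℕ → ℕ} → (∀ i → f i ≡ g i) → sumBelow N f ≡ sumBelow N g
  sumBelow-cong N eq = sumBelow-cong< N (λ i _ → eq i)

  sumBelow-+ : ∀ N (f g : ℕ → ℕ) → sumBelow N (λ i → f i + g i) ≡ sumBelow N f + sumBelow N g
  sumBelow-+ zero    f g = refl
  sumBelow-+ (suc N) f g rewrite sumBelow-+ N f g = interchange (sumBelow N f) (sumBelow N g) (f N) (g N)
    where
    interchange : ∀ a b c d → a + b + (c + d) ≡ a + c + (b + d)
    interchange = solve-∀

  sumBelow-*ˡ : ∀ N c (f : ℕ → ℕ) → sumBelow N (λ i → c * f i) ≡ c * sumBelow N f
  sumBelow-*ˡ zero    c f = sym (*-zeroʳ c)
  sumBelow-*ˡ (suc N) c f rewrite sumBelow-*ˡ N c f = sym (*-distribˡ-+ c (sumBelow N f) (f N))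

  sumBelow-const : ∀ N c → sumBelow N (λ _ → c) ≡ N * c
  sumBelow-const zero    c = refl
  sumBelow-const (suc N) c rewrite sumBelow-const N c = +-comm (N * c) c

  sumBelow-zero : ∀ N → sumBelow N (λ _ → 0) ≡ 0
  sumBelow-zero N = trans (sumBelow-const N 0) (*-zeroʳ N)

  sumBelow-vanish : ∀ N {f : ℕ → ℕ} → (∀ i → f i ≡ 0) → sumBelow N f ≡ 0
  sumBelow-vanish N f≡0 = trans (sumBelow-cong N f≡0) (sumBelow-zero N)

  sumBelow-ones : ∀ N {f : ℕ → ℕ} → (∀ i → f i ≡ 1) → sumBelow N f ≡ N
  sumBelow-ones N f≡1 = trans (sumBelow-cong N f≡1) (trans (sumBelow-const N 1) (*-identityʳ N))

  sumBelow-swap : ∀ N M (F : ℕ → ℕ → ℕ) →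
    sumBelow N (λ i → sumBelow M (F i)) ≡ sumBelow M (λ j → sumBelow N (λ i → F i j))
  sumBelow-swap zero    M F = sym (sumBelow-zero M)
  sumBelow-swap (suc N) M F rewrite sumBelow-swap N M F =
    sym (sumBelow-+ M (λ j → sumBelow N (λ i → F i j)) (F N))

  sumBelow-split : ∀ A B (f : ℕ → ℕ) → sumBelow (A + B) f ≡ sumBelow A f + sumBelow B (λ j → f (A + j))
  sumBelow-split A zero    f rewrite +-identityʳ A = sym (+-identityʳ _)
  sumBelow-split A (suc B) f rewrite +-suc A B | sumBelow-split A B f = +-assoc (sumBelow A f) _ (f (A + B))

  Periodic : ℕ → (ℕ → ℕ) → Set
  Periodic P f = ∀ i → f (P + i) ≡ f i

  sumBelow-periods : ∀ k P (f : ℕ → ℕ) → Periodic P f → sumBelow (k * P) f ≡ k * sumBelow P f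
  sumBelow-periods zero    P f per = refl
  sumBelow-periods (suc k) P f per = begin
    sumBelow (P + k * P) f                             ≡⟨ sumBelow-split P (k * P) f ⟩
    sumBelow P f + sumBelow (k * P) (λ j → f (P + j))  ≡⟨ cong (sumBelow P f +_) (sumBelow-cong (k * P) per) ⟩
    sumBelow P f + sumBelow (k * P) f                  ≡⟨ cong (sumBelow P f +_) (sumBelow-periods k P f per) ⟩
    sumBelow P f + k * sumBelow P f                    ∎

  sumBelow-evens-odds : ∀ M (f : ℕ → ℕ) →
    sumBelow (2 * M) f ≡ sumBelow M (λ i → f (2 * i)) + sumBelow M (λ i → f (suc (2 * i)))
  sumBelow-evens-odds zero    f = refl
  sumBelow-evens-odds (suc M) f = begin
    sumBelow (2 * suc M) f                         ≡⟨ cong (λ K → sumBelow K f) (*-suc 2 M) ⟩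
    sumBelow (2 * M) f + f (2 * M) + f (suc (2 * M))
      ≡⟨ cong (λ X → X + f (2 * M) + f (suc (2 * M))) (sumBelow-evens-odds M f) ⟩
    E + O + f (2 * M) + f (suc (2 * M))             ≡⟨ interchange E O (f (2 * M)) (f (suc (2 * M))) ⟩
    E + f (2 * M) + (O + f (suc (2 * M)))           ∎
    where
    E = sumBelow M (λ i → f (2 * i))
    O = sumBelow M (λ i → f (suc (2 * i)))
    interchange : ∀ a b c d → a + b + c + d ≡ a + c + (b + d)
    interchange = solve-∀

  sumBelow-rotate : ∀ M c (f : ℕ → ℕ) → Periodic M f → sumBelow M (λ i → f (i + c)) ≡ sumBelow M f
  sumBelow-rotate M zero    f per = sumBelow-cong M (λ i → cong f (+-identityʳ i))
  sumBelow-rotate M (suc c) f per = begin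
    sumBelow M (λ i → f (i + suc c))   ≡⟨ sumBelow-cong M (λ i → cong f (+-suc i c)) ⟩
    sumBelow M (λ i → g (suc i))       ≡⟨ rotate-by-one M g (λ i → trans (cong f (+-assoc M i c)) (per (i + c))) ⟩
    sumBelow M g                       ≡⟨ sumBelow-rotate M c f per ⟩
    sumBelow M f                       ∎
    where
    g : ℕ → ℕ
    g i = f (i + c)
    sumBelow-suc : ∀ M (f : ℕ → ℕ) → sumBelow (suc M) f ≡ f 0 + sumBelow M (λ i → f (suc i))
    sumBelow-suc zero    f = sym (+-identityʳ (f 0))
    sumBelow-suc (suc M) f rewrite sumBelow-suc M f = +-assoc (f 0) _ _
    rotate-by-one : ∀ M (f : ℕ → ℕ) → Periodic M f → sumBelow M (λ i → f (suc i)) ≡ sumBelow M f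
    rotate-by-one zero    f per = refl
    rotate-by-one (suc M) f per = begin
      sumBelow M (λ i → f (suc i)) + f (suc M)
        ≡⟨ cong (sumBelow M (λ i → f (suc i)) +_) (trans (cong f (sym (+-identityʳ (suc M)))) (per 0)) ⟩
      sumBelow M (λ i → f (suc i)) + f 0       ≡⟨ +-comm _ (f 0) ⟩
      f 0 + sumBelow M (λ i → f (suc i))       ≡⟨ sumBelow-suc M f ⟨
      sumBelow (suc M) f                       ∎

  δ : ℕ → ℕ → ℕ
  δ i j = if does (i ≟ j) then 1 else 0

  δ-refl : ∀ i → δ i i ≡ 1
  δ-refl i rewrite dec-true (i ≟ i) refl = refl

  δ-≢ : ∀ {i j} → i ≢ j → δ i j ≡ 0
  δ-≢ {i} {j} i≢j rewrite dec-false (i ≟ j) i≢j = refl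

  sumBelow-δ-out : ∀ N c (h : ℕ → ℕ) → N ≤ c → sumBelow N (λ i → δ i c * h i) ≡ 0
  sumBelow-δ-out zero    c h _   = refl
  sumBelow-δ-out (suc N) c h N<c
    rewrite sumBelow-δ-out N c h (<⇒≤ N<c) | δ-≢ {N} {c} (<⇒≢ N<c) = refl

  sumBelow-δ : ∀ N c (h : ℕ → ℕ) → c < N → sumBelow N (λ i → δ i c * h i) ≡ h c
  sumBelow-δ (suc N) c h c<1+N with c ≟ N
  ... | yes refl rewrite sumBelow-δ-out N N h ≤-refl | δ-refl N = +-identityʳ (h N)
  ... | no c≢N rewrite sumBelow-δ N c h (≤∧≢⇒< (≤-pred c<1+N) c≢N) | δ-≢ (c≢N ∘ sym) = +-identityʳ (h c)

  -- Unlike 2 ^ i * X, the term 2^ i · 2 ^ s is definitionally 2 ^ (i + s) for a literal i.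
  infixr 7 2^_·_

  2^_·_ : ℕ → ℕ → ℕ
  2^ zero  · X = X
  2^ suc i · X = 2 * (2^ i · X)

  Periodic-2^· : ∀ i {P f} → Periodic P f → Periodic (2^ i · P) f
  Periodic-2^· zero    per = per
  Periodic-2^· (suc i) {P} {f} per j = begin
    f (2 * Q + j)          ≡⟨ cong (λ k → f (k + j)) (cong (Q +_) (+-identityʳ Q)) ⟩
    f (Q + Q + j)          ≡⟨ cong f (+-assoc Q Q j) ⟩
    f (Q + (Q + j))        ≡⟨ per′ (Q + j) ⟩
    f (Q + j)              ≡⟨ per′ j ⟩
    f j                    ∎
    where
    Q = 2^ i · P
    per′ = Periodic-2^· i per

  sumBelow-2^· : ∀ i P f → Periodic P f → sumBelow (2^ i · P) f ≡ 2^ i · sumBelow P f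
  sumBelow-2^· zero    P f per = refl
  sumBelow-2^· (suc i) P f per =
    trans (sumBelow-periods 2 (2^ i · P) f (Periodic-2^· i per)) (cong (2 *_) (sumBelow-2^· i P f per))

  sumBelow-pull-2^· : ∀ i N (G : ℕ → ℕ) → sumBelow N (λ y → 2^ i · G y) ≡ 2^ i · sumBelow N G
  sumBelow-pull-2^· zero    N G = refl
  sumBelow-pull-2^· (suc i) N G = trans (sumBelow-*ˡ N 2 _) (cong (2 *_) (sumBelow-pull-2^· i N G))

  sumBelow²-periodic : ∀ b c P (g : ℕ → ℕ → ℕ) → (∀ z → Periodic P (λ y → g y z)) → (∀ y → Periodic P (g y)) →
    (sumBelow (2^ b · P) λ y → sumBelow (2^ c · P) λ z → g y z) ≡ 2^ c · 2^ b · (sumBelow P λ y → sumBelow P λ z → g y z)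
  sumBelow²-periodic b c P g per-y per-z = begin
    (sumBelow (2^ b · P) λ y → sumBelow (2^ c · P) (g y))   ≡⟨ sumBelow-cong (2^ b · P) (λ y → sumBelow-2^· c P (g y) (per-z y)) ⟩
    (sumBelow (2^ b · P) λ y → 2^ c · sumBelow P (g y))      ≡⟨ sumBelow-pull-2^· c (2^ b · P) _ ⟩
    2^ c · (sumBelow (2^ b · P) λ y → sumBelow P (g y))
      ≡⟨ cong (2^ c ·_) (sumBelow-2^· b P _ (λ y → sumBelow-cong P (λ z → per-y z y))) ⟩
    2^ c · 2^ b · (sumBelow P λ y → sumBelow P (g y))        ∎

module Reindexing where

  open Sums

  open import Data.Nat using (ℕ; _*_; _<_; _≟_)
  open import Data.Nat.Properties
  open import Data.Product using (_×_; _,_)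
  open import Data.Product.Properties using (≡-dec)
  open import Relation.Binary.Definitions using (DecidableEquality)
  open import Relation.Nullary using (yes; no)
  open import Data.Empty using (⊥-elim)
  open import Relation.Binary.PropositionalEquality
  open ≡-Reasoning

  module Reindex {A : Set} (Sum : (A → ℕ) → ℕ) (Range : A → Set)
    (δA : A → A → ℕ) (δA-refl : ∀ a → δA a a ≡ 1) (δA-≢ : ∀ {a b} → a ≢ b → δA a b ≡ 0)
    (_≟A_ : DecidableEquality A)
    (Sum-cong : ∀ {f g : A → ℕ} → (∀ a → Range a → f a ≡ g a) → Sum f ≡ Sum g)
    (Sum-swap : ∀ (F : A → A → ℕ) → Sum (λ a → Sum (F a)) ≡ Sum (λ b → Sum (λ a → F a b)))
    (Sum-δ : ∀ c (h : A → ℕ) → Range c → Sum (λ a → δA a c * h a) ≡ h c) where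

    Sum-bijection : (f g : A → A) → (∀ a → Range a → Range (f a)) → (∀ a → Range a → Range (g a)) →
      (∀ a → Range a → g (f a) ≡ a) → (∀ b → Range b → f (g b) ≡ b) →
      (h : A → ℕ) → Sum (λ a → h (f a)) ≡ Sum h
    Sum-bijection f g f∈ g∈ gf fg h = begin
      Sum (λ a → h (f a))                        ≡⟨ Sum-cong (λ a a∈ → sym (Sum-δ (f a) h (f∈ a a∈))) ⟩
      Sum (λ a → Sum (λ b → δA b (f a) * h b))   ≡⟨ Sum-swap _ ⟩
      Sum (λ b → Sum (λ a → δA b (f a) * h b))
        ≡⟨ Sum-cong (λ b b∈ → Sum-cong (λ a a∈ → cong (_* h b) (δ-transpose a b a∈ b∈))) ⟩
      Sum (λ b → Sum (λ a → δA a (g b) * h b))   ≡⟨ Sum-cong (λ b b∈ → Sum-δ (g b) (λ _ → h b) (g∈ b b∈)) ⟩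
      Sum h                                      ∎
      where
      δ-transpose : ∀ a b → Range a → Range b → δA b (f a) ≡ δA a (g b)
      δ-transpose a b a∈ b∈ with a ≟A g b
      ... | yes refl rewrite fg b b∈ = trans (δA-refl b) (sym (δA-refl (g b)))
      ... | no  a≢gb = trans (δA-≢ (λ b≡fa → a≢gb (trans (sym (gf a a∈)) (cong g (sym b≡fa))))) (sym (δA-≢ a≢gb))

  module Reindex¹ (N : ℕ) = Reindex (sumBelow N) (_< N) δ δ-refl δ-≢ _≟_ (sumBelow-cong< N) (sumBelow-swap N N) (sumBelow-δ N)

  ℕ³ : Set
  ℕ³ = ℕ × ℕ × ℕ

  sumBelow³ : ℕ → (ℕ³ → ℕ) → ℕ
  sumBelow³ N h = sumBelow N λ x → sumBelow N λ y → sumBelow N λ z → h (x , y , z)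

  Below³ : ℕ → ℕ³ → Set
  Below³ N (x , y , z) = x < N × y < N × z < N

  δ³ : ℕ³ → ℕ³ → ℕ
  δ³ (x , y , z) (a , b , c) = δ x a * (δ y b * δ z c)

  δ³-refl : ∀ v → δ³ v v ≡ 1
  δ³-refl (x , y , z) rewrite δ-refl x | δ-refl y | δ-refl z = refl

  δ³-≢ : ∀ {v w} → v ≢ w → δ³ v w ≡ 0
  δ³-≢ {x , y , z} {a , b , c} v≢w with x ≟ a | y ≟ b | z ≟ c
  ... | yes refl | yes refl | yes refl = ⊥-elim (v≢w refl)
  ... | no x≢a   | _        | _        rewrite δ-≢ x≢a = refl
  ... | yes _    | no y≢b   | _        rewrite δ-≢ y≢b = *-zeroʳ (δ x a)
  ... | yes _    | yes _    | no z≢c   rewrite δ-≢ z≢c | *-zeroʳ (δ y b) = *-zeroʳ (δ x a)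

  sumBelow³-cong : ∀ N {f g : ℕ³ → ℕ} → (∀ v → Below³ N v → f v ≡ g v) → sumBelow³ N f ≡ sumBelow³ N g
  sumBelow³-cong N eq =
    sumBelow-cong< N (λ x x<N → sumBelow-cong< N (λ y y<N → sumBelow-cong< N (λ z z<N → eq (x , y , z) (x<N , y<N , z<N))))

  sumBelow³-pull : ∀ N M (G : ℕ³ → ℕ → ℕ) → sumBelow³ N (λ v → sumBelow M (G v)) ≡ sumBelow M (λ j → sumBelow³ N (λ v → G v j))
  sumBelow³-pull N M G = begin
    sumBelow³ N (λ v → sumBelow M (G v))
      ≡⟨ sumBelow-cong N (λ x → sumBelow-cong N (λ y → sumBelow-swap N M (λ z → G (x , y , z)))) ⟩
    (sumBelow N λ x → sumBelow N λ y → sumBelow M λ j → sumBelow N λ z → G (x , y , z) j)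
      ≡⟨ sumBelow-cong N (λ x → sumBelow-swap N M _) ⟩
    (sumBelow N λ x → sumBelow M λ j → sumBelow N λ y → sumBelow N λ z → G (x , y , z) j)
      ≡⟨ sumBelow-swap N M _ ⟩
    sumBelow M (λ j → sumBelow³ N (λ v → G v j)) ∎

  sumBelow³-swap : ∀ N (F : ℕ³ → ℕ³ → ℕ) → sumBelow³ N (λ v → sumBelow³ N (F v)) ≡ sumBelow³ N (λ w → sumBelow³ N (λ v → F v w))
  sumBelow³-swap N F = begin
    sumBelow³ N (λ v → sumBelow³ N (F v))
      ≡⟨ sumBelow³-pull N N _ ⟩
    (sumBelow N λ a → sumBelow³ N λ v → sumBelow N λ b → sumBelow N λ c → F v (a , b , c))
      ≡⟨ sumBelow-cong N (λ a → sumBelow³-pull N N _) ⟩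
    (sumBelow N λ a → sumBelow N λ b → sumBelow³ N λ v → sumBelow N λ c → F v (a , b , c))
      ≡⟨ sumBelow-cong N (λ a → sumBelow-cong N (λ b → sumBelow³-pull N N _)) ⟩
    sumBelow³ N (λ w → sumBelow³ N (λ v → F v w)) ∎

  sumBelow³-δ : ∀ N c (h : ℕ³ → ℕ) → Below³ N c → sumBelow³ N (λ v → δ³ v c * h v) ≡ h c
  sumBelow³-δ N (a , b , c) h (a<N , b<N , c<N) = begin
    sumBelow³ N (λ v → δ³ v (a , b , c) * h v)
      ≡⟨ sumBelow-cong N (λ x → sumBelow-cong N (λ y → sumBelow-cong N (λ z → reassoc (δ x a) (δ y b) (δ z c) (h (x , y , z))))) ⟩
    (sumBelow N λ x → sumBelow N λ y → sumBelow N λ z → δ x a * (δ y b * (δ z c * h (x , y , z))))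
      ≡⟨ sumBelow-cong N (λ x → trans (sumBelow-cong N (λ y → sumBelow-*ˡ N (δ x a) _)) (sumBelow-*ˡ N (δ x a) _)) ⟩
    (sumBelow N λ x → δ x a * sumBelow N λ y → sumBelow N λ z → δ y b * (δ z c * h (x , y , z)))
      ≡⟨ sumBelow-δ N a _ a<N ⟩
    (sumBelow N λ y → sumBelow N λ z → δ y b * (δ z c * h (a , y , z)))
      ≡⟨ sumBelow-cong N (λ y → sumBelow-*ˡ N (δ y b) _) ⟩
    (sumBelow N λ y → δ y b * sumBelow N λ z → δ z c * h (a , y , z))
      ≡⟨ sumBelow-δ N b _ b<N ⟩
    (sumBelow N λ z → δ z c * h (a , b , z))
      ≡⟨ sumBelow-δ N c _ c<N ⟩
    h (a , b , c) ∎
    where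
    reassoc : ∀ p q r t → p * (q * r) * t ≡ p * (q * (r * t))
    reassoc p q r t = trans (*-assoc p (q * r) t) (cong (p *_) (*-assoc q r t))

  module Reindex³ (N : ℕ) = Reindex (sumBelow³ N) (Below³ N) δ³ δ³-refl δ³-≢ (≡-dec _≟_ (≡-dec _≟_ _≟_))
    (sumBelow³-cong N) (sumBelow³-swap N) (sumBelow³-δ N)

  sumBelow³-periodic : ∀ a b c P (g : ℕ → ℕ → ℕ → ℕ) →
    (∀ y z → Periodic P (λ x → g x y z)) → (∀ x z → Periodic P (λ y → g x y z)) → (∀ x y → Periodic P (g x y)) →
    (sumBelow (2^ a · P) λ x → sumBelow (2^ b · P) λ y → sumBelow (2^ c · P) λ z → g x y z)
      ≡ 2^ c · 2^ b · 2^ a · sumBelow³ P (λ (x , y , z) → g x y z)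
  sumBelow³-periodic a b c P g per-x per-y per-z = begin
    (sumBelow (2^ a · P) λ x → sumBelow (2^ b · P) λ y → sumBelow (2^ c · P) (g x y))
      ≡⟨ sumBelow-cong (2^ a · P) (λ x → sumBelow²-periodic b c P (g x) (per-y x) (per-z x)) ⟩
    (sumBelow (2^ a · P) λ x → 2^ c · 2^ b · S² x)
      ≡⟨ trans (sumBelow-pull-2^· c (2^ a · P) _) (cong (2^ c ·_) (sumBelow-pull-2^· b (2^ a · P) _)) ⟩
    2^ c · 2^ b · sumBelow (2^ a · P) S²
      ≡⟨ cong (λ X → 2^ c · 2^ b · X) (sumBelow-2^· a P S² (λ x → sumBelow-cong P (λ y → sumBelow-cong P (λ z → per-x y z x)))) ⟩
    2^ c · 2^ b · 2^ a · sumBelow P S²  ∎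
    where
    S² : ℕ → ℕ
    S² x = sumBelow P λ y → sumBelow P λ z → g x y z

module Congruences where

  open Sums

  open import Data.Nat as ℕ using (ℕ; zero; suc)
  import Data.Nat.Properties as ℕ
  import Data.Nat.Divisibility as ℕ
  open import Data.Integer using (ℤ; +_; -_; _+_; _-_; _*_; ∣_∣)
  import Data.Integer.Properties as ℤ
  open import Data.Integer.Divisibility.Signed
  open import Data.Integer.DivMod using (_%ℕ_; _/ℕ_; a≡a%ℕn+[a/ℕn]*n; n%ℕd<d)
  open import Data.Integer.Tactic.RingSolver using (solve-∀)
  open import Data.Bool using (if_then_else_)
  open import Data.Empty using (⊥-elim)
  open import Data.Product using (Σ; _,_)
  open import Data.Sum using (_⊎_; inj₁; inj₂)
  open import Relation.Nullary using (¬_; Dec; does; yes; no)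
  open import Relation.Nullary.Decidable using (dec-true; dec-false; map′)
  open import Function using (_∘_)
  open import Relation.Binary.PropositionalEquality
  open import Relation.Binary.Bundles using (Setoid)
  import Relation.Binary.Reasoning.Setoid as SetoidReasoning

  infix 4 _≡_mod_

  record _≡_mod_ (a b : ℤ) (N : ℕ) : Set where
    constructor mod-by
    field
      divides-difference : + N ∣ a - b

  open _≡_mod_ public

  mod-≡ : ∀ {N a b} (q : ℤ) → a - b ≡ q * + N → a ≡ b mod N
  mod-≡ q eq = mod-by (divides q eq)

  ≡mod-refl : ∀ {N} a → a ≡ a mod N
  ≡mod-refl a = mod-≡ (+ 0) (ℤ.+-inverseʳ a)

  ≡mod-sym : ∀ {N a b} → a ≡ b mod N → b ≡ a mod N
  ≡mod-sym {a = a} {b} (mod-by d) = mod-by (subst (_ ∣_) (difference-flip a b) (∣m⇒∣-m d))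
    where
    difference-flip : ∀ a b → - (a - b) ≡ b - a
    difference-flip = solve-∀

  ≡mod-trans : ∀ {N a b c} → a ≡ b mod N → b ≡ c mod N → a ≡ c mod N
  ≡mod-trans {a = a} {b} {c} (mod-by d) (mod-by e) = mod-by (subst (_ ∣_) (telescope a b c) (∣m∣n⇒∣m+n d e))
    where
    telescope : ∀ a b c → (a - b) + (b - c) ≡ a - c
    telescope = solve-∀

  ≡mod-setoid : ℕ → Setoid _ _
  ≡mod-setoid N = record
    { Carrier       = ℤ
    ; _≈_           = λ a b → a ≡ b mod N
    ; isEquivalence = record { refl = ≡mod-refl _ ; sym = ≡mod-sym ; trans = ≡mod-trans }
    }

  module ≡mod-Reasoning (N : ℕ) = SetoidReasoning (≡mod-setoid N)

  ≡mod-+ : ∀ {N a a′ b b′} → a ≡ a′ mod N → b ≡ b′ mod N → a + b ≡ a′ + b′ mod N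
  ≡mod-+ {a = a} {a′} {b} {b′} (mod-by d) (mod-by e) = mod-by (subst (_ ∣_) (regroup a a′ b b′) (∣m∣n⇒∣m+n d e))
    where
    regroup : ∀ a a′ b b′ → (a - a′) + (b - b′) ≡ (a + b) - (a′ + b′)
    regroup = solve-∀

  ≡mod-* : ∀ {N a a′ b b′} → a ≡ a′ mod N → b ≡ b′ mod N → a * b ≡ a′ * b′ mod N
  ≡mod-* {a = a} {a′} {b} {b′} (mod-by d) (mod-by e) =
    mod-by (subst (_ ∣_) (regroup a a′ b b′) (∣m∣n⇒∣m+n (∣m⇒∣m*n b d) (∣n⇒∣m*n a′ e)))
    where
    regroup : ∀ a a′ b b′ → (a - a′) * b + a′ * (b - b′) ≡ a * b - a′ * b′
    regroup = solve-∀

  ≡mod-neg : ∀ {N a b} → a ≡ b mod N → - a ≡ - b mod N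
  ≡mod-neg {a = a} {b} (mod-by d) = mod-by (subst (_ ∣_) (negate a b) (∣m⇒∣-m d))
    where
    negate : ∀ a b → - (a - b) ≡ - a - - b
    negate = solve-∀

  ≡mod-*ˡ : ∀ {N a b} c → a ≡ b mod N → c * a ≡ c * b mod N
  ≡mod-*ˡ c = ≡mod-* (≡mod-refl c)

  ≡mod-∣ : ∀ {N a b} → a ≡ b mod N → + N ∣ b → + N ∣ a
  ≡mod-∣ {a = a} {b} (mod-by d) N∣b = subst (_ ∣_) (cancel a b) (∣m∣n⇒∣m+n d N∣b)
    where
    cancel : ∀ a b → (a - b) + b ≡ a
    cancel = solve-∀

  ≡mod-residue : ∀ N .{{_ : ℕ.NonZero N}} a → + (a %ℕ N) ≡ a mod N
  ≡mod-residue N a = mod-≡ (- (a /ℕ N)) (begin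
    + (a %ℕ N) - a                             ≡⟨ cong (λ t → + (a %ℕ N) - t) (a≡a%ℕn+[a/ℕn]*n a N) ⟩
    + (a %ℕ N) - (+ (a %ℕ N) + a /ℕ N * + N)   ≡⟨ cancel (+ (a %ℕ N)) (a /ℕ N) (+ N) ⟩
    - (a /ℕ N) * + N                           ∎)
    where
    open ≡-Reasoning
    cancel : ∀ r q n → r - (r + q * n) ≡ - q * n
    cancel = solve-∀

  residue-unique-≤ : ∀ {N p q} → p ℕ.≤ q → q ℕ.< N → + p ≡ + q mod N → p ≡ q
  residue-unique-≤ {N} {p} {q} p≤q q<N (mod-by d) =
    ℕ.≤-antisym p≤q (ℕ.m∸n≡0⇒m≤n (small (ℕ.≤-<-trans (ℕ.m∸n≤m q p) q<N)))
    where
    N∣q∸p : N ℕ.∣ q ℕ.∸ p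
    N∣q∸p = subst (N ℕ.∣_) (trans (cong ∣_∣ (ℤ.m-n≡m⊖n p q)) (ℤ.∣⊖∣-≤ p≤q)) (∣⇒∣ᵤ d)
    small : q ℕ.∸ p ℕ.< N → q ℕ.∸ p ≡ 0
    small lt with q ℕ.∸ p | N∣q∸p
    ... | zero  | _   = refl
    ... | suc _ | N∣d = ⊥-elim (ℕ.<⇒≱ lt (ℕ.∣⇒≤ N∣d))

  residue-unique : ∀ {N p q} → p ℕ.< N → q ℕ.< N → + p ≡ + q mod N → p ≡ q
  residue-unique {p = p} {q} p<N q<N p≡q with ℕ.≤-total p q
  ... | inj₁ p≤q = residue-unique-≤ p≤q q<N p≡q
  ... | inj₂ q≤p = sym (residue-unique-≤ q≤p p<N (≡mod-sym p≡q))

  ≡mod⇒%ℕ≡ : ∀ {N a p} .{{_ : ℕ.NonZero N}} → p ℕ.< N → a ≡ + p mod N → a %ℕ N ≡ p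
  ≡mod⇒%ℕ≡ {N} {a} p<N a≡p = residue-unique (n%ℕd<d a N) p<N (≡mod-trans (≡mod-residue N a) a≡p)

  -- The summand of count2, so that counts unfold definitionally to sums of 𝟙[_∣_].
  𝟙[_∣_] : ℕ → ℤ → ℕ
  𝟙[ N ∣ i ] = if does (N ℕ.∣? ∣ i ∣) then 1 else 0

  +∣? : ∀ N i → Dec (+ N ∣ i)
  +∣? N i = map′ ∣ᵤ⇒∣ ∣⇒∣ᵤ (N ℕ.∣? ∣ i ∣)

  𝟙-∣ : ∀ {N i} → + N ∣ i → 𝟙[ N ∣ i ] ≡ 1
  𝟙-∣ {N} {i} N∣i rewrite dec-true (N ℕ.∣? ∣ i ∣) (∣⇒∣ᵤ N∣i) = refl

  𝟙-∤ : ∀ {N i} → ¬ (+ N ∣ i) → 𝟙[ N ∣ i ] ≡ 0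
  𝟙-∤ {N} {i} N∤i rewrite dec-false (N ℕ.∣? ∣ i ∣) (N∤i ∘ ∣ᵤ⇒∣) = refl

  𝟙-cong : ∀ {N i j} → i ≡ j mod N → 𝟙[ N ∣ i ] ≡ 𝟙[ N ∣ j ]
  𝟙-cong {N} {i} {j} i≡j with +∣? N j
  ... | yes N∣j = trans (𝟙-∣ (≡mod-∣ i≡j N∣j)) (sym (𝟙-∣ N∣j))
  ... | no  N∤j = trans (𝟙-∤ (N∤j ∘ ≡mod-∣ (≡mod-sym i≡j))) (sym (𝟙-∤ N∤j))

  𝟙-neg : ∀ N a → 𝟙[ N ∣ - a ] ≡ 𝟙[ N ∣ a ]
  𝟙-neg N a with +∣? N a
  ... | yes N∣a = trans (𝟙-∣ (∣m⇒∣-m N∣a)) (sym (𝟙-∣ N∣a))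
  ... | no  N∤a = trans (𝟙-∤ (λ N∣-a → N∤a (subst (_ ∣_) (ℤ.neg-involutive a) (∣m⇒∣-m N∣-a)))) (sym (𝟙-∤ N∤a))

  𝟙-unit : ∀ {N} u w X → u * w ≡ + 1 mod N → 𝟙[ N ∣ w * X ] ≡ 𝟙[ N ∣ X ]
  𝟙-unit {N} u w X uw≡1 with +∣? N X
  ... | yes N∣X = trans (𝟙-∣ (∣n⇒∣m*n w N∣X)) (sym (𝟙-∣ N∣X))
  ... | no  N∤X = trans (𝟙-∤ (λ N∣wX → N∤X (≡mod-∣ X≡uwX (∣n⇒∣m*n u N∣wX)))) (sym (𝟙-∤ N∤X))
    where
    X≡uwX : X ≡ u * (w * X) mod N
    X≡uwX = ≡mod-sym (subst₂ (λ a b → a ≡ b mod N) (ℤ.*-assoc u w X) (ℤ.*-identityˡ X)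
                               (≡mod-* uw≡1 (≡mod-refl X)))

  𝟙-double : ∀ M i → 𝟙[ 2 ℕ.* M ∣ + 2 * i ] ≡ 𝟙[ M ∣ i ]
  𝟙-double M i rewrite ℤ.abs-* (+ 2) i with M ℕ.∣? ∣ i ∣
  ... | yes M∣i rewrite dec-true ((2 ℕ.* M) ℕ.∣? (2 ℕ.* ∣ i ∣)) (ℕ.*-monoʳ-∣ 2 M∣i) = refl
  ... | no  M∤i rewrite dec-false ((2 ℕ.* M) ℕ.∣? (2 ℕ.* ∣ i ∣)) (M∤i ∘ ℕ.*-cancelˡ-∣ 2) = refl

  𝟙-periodic : ∀ N P (f : ℤ → ℤ) → (∀ a → f (+ P + a) ≡ f a mod N) → Periodic P (λ i → 𝟙[ N ∣ f (+ i) ])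
  𝟙-periodic N P f shift i = 𝟙-cong (shift (+ i))

  Odd : ℤ → Set
  Odd i = Σ ℤ λ q → i ≡ + 1 + q * + 2

  parity : ∀ i → + 2 ∣ i ⊎ Odd i
  parity i with i %ℕ 2 | n%ℕd<d i 2 | a≡a%ℕn+[a/ℕn]*n i 2
  ... | 0           | _               | i≡ = inj₁ (divides (i /ℕ 2) (trans i≡ (ℤ.+-identityˡ _)))
  ... | 1           | _               | i≡ = inj₂ (i /ℕ 2 , i≡)
  ... | suc (suc _) | ℕ.s≤s (ℕ.s≤s ()) | _

  Odd⇒∤ : ∀ {i} → Odd i → ¬ (+ 2 ∣ i)
  Odd⇒∤ (q , refl) 2∣1+2q = 2∤1 (subst (_ ∣_) (cancel q) (∣m∣n⇒∣m-n 2∣1+2q (divides q refl)))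
    where
    cancel : ∀ q → + 1 + q * + 2 - q * + 2 ≡ + 1
    cancel = solve-∀
    2∤1 : ¬ (+ 2 ∣ + 1)
    2∤1 2∣1 with ℕ.∣⇒≤ (∣⇒∣ᵤ 2∣1)
    ... | ℕ.s≤s ()

  ∤⇒Odd : ∀ {i} → ¬ (+ 2 ∣ i) → Odd i
  ∤⇒Odd {i} 2∤i with parity i
  ... | inj₁ 2∣i = ⊥-elim (2∤i 2∣i)
  ... | inj₂ odd = odd

  Odd-* : ∀ {a b} → Odd a → Odd b → Odd (a * b)
  Odd-* (p , refl) (q , refl) = p + q + p * q * + 2 , expand p q
    where
    expand : ∀ p q → (+ 1 + p * + 2) * (+ 1 + q * + 2) ≡ + 1 + (p + q + p * q * + 2) * + 2
    expand = solve-∀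

  +2* : ∀ x → + (2 ℕ.* x) ≡ + 2 * + x
  +2* = ℤ.pos-* 2

  +1+2* : ∀ x → + suc (2 ℕ.* x) ≡ + 1 + + 2 * + x
  +1+2* x = trans (ℤ.pos-+ 1 (2 ℕ.* x)) (cong (_+_ (+ 1)) (+2* x))

  Odd-1+2* : ∀ x → Odd (+ suc (2 ℕ.* x))
  Odd-1+2* x = + x , trans (+1+2* x) (cong (_+_ (+ 1)) (ℤ.*-comm (+ 2) (+ x)))

  2∣2* : ∀ X → + 2 ∣ + 2 * X
  2∣2* X = divides X (ℤ.*-comm (+ 2) X)

  2∣+2* : ∀ x → + 2 ∣ + (2 ℕ.* x)
  2∣+2* x = subst (_ ∣_) (sym (+2* x)) (2∣2* (+ x))

  2∤2*-odd : ∀ X {c} → Odd c → ¬ (+ 2 ∣ + 2 * X - c)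
  2∤2*-odd X {c} odd 2∣ = Odd⇒∤ odd (subst (_ ∣_) (cancel X c) (∣m∣n⇒∣m-n (2∣2* X) 2∣))
    where
    cancel : ∀ X c → + 2 * X - (+ 2 * X - c) ≡ c
    cancel = solve-∀

  𝟙-odd : ∀ M {i} → ¬ (+ 2 ∣ i) → 𝟙[ 2 ℕ.* M ∣ i ] ≡ 0
  𝟙-odd M 2∤i = 𝟙-∤ (λ 2M∣i → 2∤i (∣-trans (2∣+2* M) 2M∣i))

  𝟙-residue : ∀ {N z r} → z ℕ.< N → r ℕ.< N → 𝟙[ N ∣ + z - + r ] ≡ δ z r
  𝟙-residue {N} {z} {r} z<N r<N with z ℕ.≟ r
  ... | yes refl rewrite δ-refl z = 𝟙-∣ {N} (divides (+ 0) (ℤ.+-inverseʳ (+ z)))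
  ... | no  z≢r  rewrite δ-≢ z≢r  = 𝟙-∤ (λ N∣ → z≢r (residue-unique z<N r<N (mod-by N∣)))

  sumBelow-𝟙-mod : ∀ N .{{_ : ℕ.NonZero N}} c → sumBelow N (λ z → 𝟙[ N ∣ + z - c ]) ≡ 1
  sumBelow-𝟙-mod N c = begin
    sumBelow N (λ z → 𝟙[ N ∣ + z - c ])          ≡⟨ sumBelow-cong< N (λ z z<N → trans (𝟙-cong (shift z)) (𝟙-residue z<N r<N)) ⟩
    sumBelow N (λ z → δ z r)                      ≡⟨ sumBelow-cong N (λ z → sym (ℕ.*-identityʳ (δ z r))) ⟩
    sumBelow N (λ z → δ z r ℕ.* 1)                ≡⟨ sumBelow-δ N r (λ _ → 1) r<N ⟩
    1                                             ∎
    where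
    open ≡-Reasoning
    r = c %ℕ N
    r<N = n%ℕd<d c N
    shift : ∀ z → + z - c ≡ + z - + r mod N
    shift z = ≡mod-+ (≡mod-refl (+ z)) (≡mod-neg (≡mod-sym (≡mod-residue N c)))

module TwoAdicCounts where

  open Sums
  open Congruences

  open import Data.Nat as ℕ using (ℕ; zero; suc; _^_)
  import Data.Nat.Properties as ℕ
  import Data.Nat.Tactic.RingSolver as ℕ-Solver
  open import Data.Integer using (ℤ; +_; -_; _+_; _-_; _*_)
  import Data.Integer.Properties as ℤ
  open import Data.Integer.Divisibility.Signed
  open import Data.Integer.Tactic.RingSolver using (solve-∀)
  open import Data.Product using (Σ; _,_)
  open import Data.Sum using (inj₁; inj₂)
  open import Relation.Binary.PropositionalEquality
  open ≡-Reasoning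

  +2^suc : ∀ s → + (2 ^ suc s) ≡ + 2 * + (2 ^ s)
  +2^suc s = ℤ.pos-* 2 (2 ^ s)

  odd-invertible : ∀ s {u} → Odd u → Σ ℤ λ w → u * w ≡ + 1 mod 2 ^ s
  odd-invertible zero    {u} _ = + 0 , mod-≡ (u * + 0 - + 1) (sym (ℤ.*-identityʳ _))
  odd-invertible (suc s) {u} odd@(j , u≡) with odd-invertible s odd
  ... | w , mod-by (divides q uw-1≡) with parity q
  ...   | inj₁ (divides k q≡) = w , mod-≡ k (begin
          u * w - + 1              ≡⟨ uw-1≡ ⟩
          q * + (2 ^ s)            ≡⟨ cong (_* + (2 ^ s)) q≡ ⟩
          k * + 2 * + (2 ^ s)      ≡⟨ ℤ.*-assoc k (+ 2) (+ (2 ^ s)) ⟩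
          k * (+ 2 * + (2 ^ s))    ≡⟨ cong (k *_) (+2^suc s) ⟨
          k * + (2 ^ suc s)        ∎)
  ...   | inj₂ (k , q≡) = w + + (2 ^ s) , mod-≡ (+ 1 + k + j) (begin
          u * (w + P) - + 1               ≡⟨ split u w P ⟩
          (u * w - + 1) + u * P           ≡⟨ cong₂ (λ a b → a + b * P) (trans uw-1≡ (cong (_* P) q≡)) u≡ ⟩
          (+ 1 + k * + 2) * P + (+ 1 + j * + 2) * P  ≡⟨ collect k j P ⟩
          (+ 1 + k + j) * (+ 2 * P)       ≡⟨ cong ((+ 1 + k + j) *_) (+2^suc s) ⟨
          (+ 1 + k + j) * + (2 ^ suc s)   ∎)
    where
    P = + (2 ^ s)
    split : ∀ u w P → u * (w + P) - + 1 ≡ (u * w - + 1) + u * P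
    split = solve-∀
    collect : ∀ k j P → (+ 1 + k * + 2) * P + (+ 1 + j * + 2) * P ≡ (+ 1 + k + j) * (+ 2 * P)
    collect = solve-∀

  odd-congruence-unique : ∀ s {u} c → Odd u → sumBelow (2 ^ s) (λ z → 𝟙[ 2 ^ s ∣ u * + z - c ]) ≡ 1
  odd-congruence-unique s {u} c odd with odd-invertible s odd
  ... | w , uw≡1 = trans (sumBelow-cong (2 ^ s) solve-for-z) (sumBelow-𝟙-mod (2 ^ s) {{ℕ.m^n≢0 2 s}} (w * c))
    where
    wu≡1 : w * u ≡ + 1 mod 2 ^ s
    wu≡1 = subst (λ a → a ≡ + 1 mod 2 ^ s) (ℤ.*-comm u w) uw≡1
    solve-for-z : ∀ z → 𝟙[ 2 ^ s ∣ u * + z - c ] ≡ 𝟙[ 2 ^ s ∣ + z - w * c ]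
    solve-for-z z = trans (sym (𝟙-unit u w (u * + z - c) uw≡1)) (𝟙-cong multiply-by-w)
      where
      regroup : ∀ w u z c → (w * u - + 1) * z ≡ w * (u * z - c) - (z - w * c)
      regroup = solve-∀
      multiply-by-w : w * (u * + z - c) ≡ + z - w * c mod 2 ^ s
      multiply-by-w = mod-by (subst (_ ∣_) (regroup w u (+ z) c) (∣m⇒∣m*n (+ z) (divides-difference wu≡1)))

  even-congruence-count : ∀ s {u} c → Odd u →
    sumBelow (2 ^ s) (λ w → 𝟙[ 2 ^ suc s ∣ + 2 * (u * + w) - c ]) ≡ 𝟙[ 2 ∣ c ]
  even-congruence-count s {u} c odd with parity c
  ... | inj₁ (divides k refl) = begin
    sumBelow (2 ^ s) (λ w → 𝟙[ 2 ^ suc s ∣ + 2 * (u * + w) - k * + 2 ])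
      ≡⟨ sumBelow-cong (2 ^ s) (λ w → trans (cong 𝟙[ 2 ^ suc s ∣_] (factor-2 (u * + w) k)) (𝟙-double (2 ^ s) (u * + w - k))) ⟩
    sumBelow (2 ^ s) (λ w → 𝟙[ 2 ^ s ∣ u * + w - k ])   ≡⟨ odd-congruence-unique s k odd ⟩
    1                                                    ≡⟨ 𝟙-∣ {2} (divides k refl) ⟨
    𝟙[ 2 ∣ k * + 2 ]                                     ∎
    where
    factor-2 : ∀ a k → + 2 * a - k * + 2 ≡ + 2 * (a - k)
    factor-2 = solve-∀
  ... | inj₂ odd-c = begin
    sumBelow (2 ^ s) (λ w → 𝟙[ 2 ^ suc s ∣ + 2 * (u * + w) - c ])
      ≡⟨ sumBelow-vanish (2 ^ s) (λ w → 𝟙-odd (2 ^ s) (2∤2*-odd (u * + w) odd-c)) ⟩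
    0                           ≡⟨ 𝟙-∤ {2} (Odd⇒∤ odd-c) ⟨
    𝟙[ 2 ∣ c ]                  ∎

  productCount : ℕ → ℤ → ℕ
  productCount s c = sumBelow (2 ^ s) λ y → sumBelow (2 ^ s) λ z → 𝟙[ 2 ^ s ∣ + y * + z - c ]

  odd-product-count : ∀ s {c} → Odd c → productCount (suc s) c ≡ 2 ^ s
  odd-product-count s {c} odd-c = begin
    sumBelow (2 ^ suc s) (λ y → Y y)                                   ≡⟨ sumBelow-evens-odds (2 ^ s) Y ⟩
    sumBelow (2 ^ s) (λ y → Y (2 ℕ.* y)) ℕ.+ sumBelow (2 ^ s) (λ y → Y (suc (2 ℕ.* y)))
      ≡⟨ cong₂ ℕ._+_ (sumBelow-vanish (2 ^ s) even-y)
                     (sumBelow-ones (2 ^ s) (λ y → odd-congruence-unique (suc s) c (Odd-1+2* y))) ⟩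
    2 ^ s                                                              ∎
    where
    Y : ℕ → ℕ
    Y y = sumBelow (2 ^ suc s) (λ z → 𝟙[ 2 ^ suc s ∣ + y * + z - c ])
    regroup : ∀ y z c → + 2 * y * z - c ≡ + 2 * (y * z) - c
    regroup = solve-∀
    even-y : ∀ y → Y (2 ℕ.* y) ≡ 0
    even-y y = sumBelow-vanish (2 ^ suc s) (λ z → begin
      𝟙[ 2 ^ suc s ∣ + (2 ℕ.* y) * + z - c ]  ≡⟨ cong (λ a → 𝟙[ 2 ^ suc s ∣ a * + z - c ]) (+2* y) ⟩
      𝟙[ 2 ^ suc s ∣ + 2 * + y * + z - c ]    ≡⟨ cong 𝟙[ 2 ^ suc s ∣_] (regroup (+ y) (+ z) c) ⟩
      𝟙[ 2 ^ suc s ∣ + 2 * (+ y * + z) - c ]  ≡⟨ 𝟙-odd (2 ^ s) (2∤2*-odd (+ y * + z) odd-c) ⟩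
      0                                       ∎)

  even-product-count : ∀ s →
    sumBelow (2 ^ suc s) (λ y → sumBelow (2 ^ suc s) (λ z → 𝟙[ 2 ∣ + y * + z ])) ≡ 3 ℕ.* (2 ^ s ℕ.* 2 ^ s)
  even-product-count s = begin
    sumBelow (2 ^ suc s) Y                                             ≡⟨ sumBelow-evens-odds P Y ⟩
    sumBelow P (λ y → Y (2 ℕ.* y)) ℕ.+ sumBelow P (λ y → Y (suc (2 ℕ.* y)))
      ≡⟨ cong₂ ℕ._+_ (trans (sumBelow-cong P even-y) (sumBelow-const P (2 ℕ.* P))) (trans (sumBelow-cong P odd-y) (sumBelow-const P P)) ⟩
    P ℕ.* (2 ℕ.* P) ℕ.+ P ℕ.* P                                        ≡⟨ thrice P ⟩
    3 ℕ.* (P ℕ.* P)                                                    ∎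
    where
    P = 2 ^ s
    thrice : ∀ P → P ℕ.* (2 ℕ.* P) ℕ.+ P ℕ.* P ≡ 3 ℕ.* (P ℕ.* P)
    thrice = ℕ-Solver.solve-∀
    Y : ℕ → ℕ
    Y y = sumBelow (2 ^ suc s) (λ z → 𝟙[ 2 ∣ + y * + z ])
    even-y : ∀ y → Y (2 ℕ.* y) ≡ 2 ℕ.* P
    even-y y = sumBelow-ones (2 ^ suc s) (λ z → 𝟙-∣ {2} (∣m⇒∣m*n (+ z) (2∣+2* y)))
    odd-y : ∀ y → Y (suc (2 ℕ.* y)) ≡ P
    odd-y y = begin
      Y (suc (2 ℕ.* y))       ≡⟨ sumBelow-evens-odds P _ ⟩
      sumBelow P (λ z → 𝟙[ 2 ∣ + suc (2 ℕ.* y) * + (2 ℕ.* z) ]) ℕ.+ sumBelow P (λ z → 𝟙[ 2 ∣ + suc (2 ℕ.* y) * + suc (2 ℕ.* z) ])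
        ≡⟨ cong₂ ℕ._+_ (sumBelow-ones P (λ z → 𝟙-∣ {2} (∣n⇒∣m*n (+ suc (2 ℕ.* y)) (2∣+2* z))))
                       (sumBelow-vanish P (λ z → 𝟙-∤ {2} (Odd⇒∤ (Odd-* (Odd-1+2* y) (Odd-1+2* z))))) ⟩
      P ℕ.+ 0                 ≡⟨ ℕ.+-identityʳ P ⟩
      P                       ∎

  𝟙-2-consecutive : ∀ m → 𝟙[ 2 ∣ m ] ℕ.+ 𝟙[ 2 ∣ m + + 1 ] ≡ 1
  𝟙-2-consecutive m with parity m
  ... | inj₁ 2∣m = cong₂ ℕ._+_ (𝟙-∣ 2∣m) (𝟙-∤ (Odd⇒∤ (odd-successor 2∣m)))
    where
    odd-successor : ∀ {m} → + 2 ∣ m → Odd (m + + 1)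
    odd-successor (divides k refl) = k , ℤ.+-comm (k * + 2) (+ 1)
  ... | inj₂ odd-m = cong₂ ℕ._+_ (𝟙-∤ (Odd⇒∤ odd-m)) (𝟙-∣ (even-successor odd-m))
    where
    regroup : ∀ q → + 1 + q * + 2 + + 1 ≡ (q + + 1) * + 2
    regroup = solve-∀
    even-successor : ∀ {m} → Odd m → + 2 ∣ m + + 1
    even-successor (q , refl) = divides (q + + 1) (regroup q)

  2∣n[n+1] : ∀ a → + 2 ∣ a * (a + + 1)
  2∣n[n+1] a with parity a
  ... | inj₁ (divides k refl) = divides (k * (k * + 2 + + 1)) (even-case k)
    where
    even-case : ∀ k → k * + 2 * (k * + 2 + + 1) ≡ (k * (k * + 2 + + 1)) * + 2
    even-case = solve-∀
  ... | inj₂ (q , refl) = divides ((+ 1 + q * + 2) * (q + + 1)) (odd-case q)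
    where
    odd-case : ∀ q → (+ 1 + q * + 2) * (+ 1 + q * + 2 + + 1) ≡ ((+ 1 + q * + 2) * (q + + 1)) * + 2
    odd-case = solve-∀

  𝟙[yz-c]-periodicʸ : ∀ M c z → Periodic M (λ y → 𝟙[ M ∣ + y * + z - c ])
  𝟙[yz-c]-periodicʸ M c z = 𝟙-periodic M M (λ a → a * + z - c) (λ a → mod-≡ (+ z) (shift (+ M) a (+ z) c))
    where
    shift : ∀ P a z c → ((P + a) * z - c) - (a * z - c) ≡ z * P
    shift = solve-∀

  𝟙[yz-c]-periodicᶻ : ∀ M c y → Periodic M (λ z → 𝟙[ M ∣ + y * + z - c ])
  𝟙[yz-c]-periodicᶻ M c y = 𝟙-periodic M M (λ a → + y * a - c) (λ a → mod-≡ (+ y) (shift (+ M) (+ y) a c))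
    where
    shift : ∀ P y a c → (y * (P + a) - c) - (y * a - c) ≡ y * P
    shift = solve-∀

module TargetCount where

  open Sums
  open Congruences
  open TwoAdicCounts
  open Reindexing

  open import Data.Nat as ℕ using (ℕ; suc; _^_)
  import Data.Nat.Properties as ℕ
  import Data.Nat.Tactic.RingSolver as ℕ-Solver
  open import Data.Integer using (ℤ; +_; -_; _+_; _-_; _*_)
  open import Data.Integer.Tactic.RingSolver using (solve-∀)
  open import Data.Product using (_,_)
  open import Relation.Binary.PropositionalEquality
  open ≡-Reasoning

  count₄ˣ : ℤ → ℕ → ℕ → ℕ
  count₄ˣ m t x = sumBelow (2 ^ t) λ y → sumBelow (2 ^ t) λ z → 𝟙[ 2 ^ t ∣ + 4 * (+ y * + z) - (+ x * + x + m) ]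

  count₄ : ℤ → ℕ → ℕ
  count₄ m t = sumBelow (2 ^ t) (count₄ˣ m t)

  count₁ : ℤ → ℕ → ℕ
  count₁ m s = sumBelow³ (2 ^ s) λ (x , y , z) → 𝟙[ 2 ^ s ∣ + y * + z - (+ x * + x + m) ]

  count2-target : ∀ m t → count2 target m t ≡ count₄ m t
  count2-target m t =
    sumBelow-cong (2 ^ t) λ x → sumBelow-cong (2 ^ t) λ y → sumBelow-cong (2 ^ t) λ z →
      cong 𝟙[ 2 ^ t ∣_] (unfold-target (+ x) (+ y) (+ z) m)
    where
    unfold-target : ∀ x y z m →
      - + 1 * x * x + + 0 * y * y + + 0 * z * z + + 4 * y * z + + 0 * z * x + + 0 * x * y - m ≡ + 4 * (y * z) - (x * x + m)
    unfold-target = solve-∀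

  count₄-4* : ∀ m s → count₄ (+ 4 * m) (suc (suc s)) ≡ 32 ℕ.* count₁ m s
  count₄-4* m s = begin
    count₄ (+ 4 * m) (suc (suc s))
      ≡⟨ sumBelow-evens-odds (2 ℕ.* P) _ ⟩
    sumBelow (2 ℕ.* P) (λ x → Σyz (2 ℕ.* x)) ℕ.+ sumBelow (2 ℕ.* P) (λ x → Σyz (suc (2 ℕ.* x)))
      ≡⟨ cong₂ ℕ._+_ (sumBelow-cong (2 ℕ.* P) λ x → sumBelow-cong N λ y → sumBelow-cong N λ z → even-x x y z)
                     (sumBelow-vanish (2 ℕ.* P) λ x → sumBelow-vanish N λ y → sumBelow-vanish N λ z → odd-x x y z) ⟩
    (sumBelow (2^ 1 · P) λ x → sumBelow (2^ 2 · P) λ y → sumBelow (2^ 2 · P) λ z → g x y z) ℕ.+ 0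
      ≡⟨ cong (ℕ._+ 0) (sumBelow³-periodic 1 2 2 P g
           (λ y z → 𝟙-periodic P P (λ a → + y * + z - (a * a + m)) (λ a → mod-≡ (- (+ 2 * a + + P)) (shift-x (+ P) a (+ y * + z) m)))
           (λ x → 𝟙[yz-c]-periodicʸ P (+ x * + x + m))
           (λ x → 𝟙[yz-c]-periodicᶻ P (+ x * + x + m))) ⟩
    2^ 2 · 2^ 2 · 2^ 1 · count₁ m s ℕ.+ 0
      ≡⟨ thirty-two (count₁ m s) ⟩
    32 ℕ.* count₁ m s ∎
    where
    P = 2 ^ s
    N = 2 ℕ.* (2 ℕ.* P)
    Σyz = count₄ˣ (+ 4 * m) (suc (suc s))
    g : ℕ → ℕ → ℕ → ℕ
    g x y z = 𝟙[ P ∣ + y * + z - (+ x * + x + m) ]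
    shift-x : ∀ P a b m → (b - ((P + a) * (P + a) + m)) - (b - (a * a + m)) ≡ - (+ 2 * a + P) * P
    shift-x = solve-∀
    thirty-two : ∀ X → 2 ℕ.* (2 ℕ.* (2 ℕ.* (2 ℕ.* (2 ℕ.* X)))) ℕ.+ 0 ≡ 32 ℕ.* X
    thirty-two = ℕ-Solver.solve-∀
    factor-4 : ∀ y z x m → + 4 * (y * z) - (+ 2 * x * (+ 2 * x) + + 4 * m) ≡ + 2 * (+ 2 * (y * z - (x * x + m)))
    factor-4 = solve-∀
    even-part : ∀ y z x m → + 4 * (y * z) - (x * x + + 4 * m) ≡ + 2 * (+ 2 * (y * z) - + 2 * m) - x * x
    even-part = solve-∀
    even-x : ∀ x y z → 𝟙[ N ∣ + 4 * (+ y * + z) - (+ (2 ℕ.* x) * + (2 ℕ.* x) + + 4 * m) ] ≡ g x y z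
    even-x x y z = begin
      𝟙[ N ∣ + 4 * (+ y * + z) - (+ (2 ℕ.* x) * + (2 ℕ.* x) + + 4 * m) ]
        ≡⟨ cong (λ a → 𝟙[ N ∣ + 4 * (+ y * + z) - (a * a + + 4 * m) ]) (+2* x) ⟩
      𝟙[ N ∣ + 4 * (+ y * + z) - (+ 2 * + x * (+ 2 * + x) + + 4 * m) ]
        ≡⟨ cong 𝟙[ N ∣_] (factor-4 (+ y) (+ z) (+ x) m) ⟩
      𝟙[ 2 ℕ.* (2 ℕ.* P) ∣ + 2 * (+ 2 * (+ y * + z - (+ x * + x + m))) ]
        ≡⟨ trans (𝟙-double (2 ℕ.* P) (+ 2 * D)) (𝟙-double P D) ⟩
      g x y z ∎
      where
      D = + y * + z - (+ x * + x + m)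
    odd-x : ∀ x y z → 𝟙[ N ∣ + 4 * (+ y * + z) - (+ suc (2 ℕ.* x) * + suc (2 ℕ.* x) + + 4 * m) ] ≡ 0
    odd-x x y z = trans (cong 𝟙[ N ∣_] (even-part (+ y) (+ z) (+ suc (2 ℕ.* x)) m))
                        (𝟙-odd (2 ℕ.* P) (2∤2*-odd (+ 2 * (+ y * + z) - + 2 * m) (Odd-* (Odd-1+2* x) (Odd-1+2* x))))

  module _ (s : ℕ) where
    private
      P = 2 ^ s
      N = 2 ℕ.* P

    quarterCount : ℤ → ℕ
    quarterCount c = sumBelow P λ y → sumBelow P λ z → 𝟙[ N ∣ + 4 * (+ y * + z) - c ]

    productCount-split : ∀ c → productCount (suc s) c ≡ quarterCount c ℕ.+ P ℕ.* 𝟙[ 2 ∣ c ] ℕ.+ P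
    productCount-split c = begin
      sumBelow N (λ y → Σz y)                                              ≡⟨ sumBelow-evens-odds P Σz ⟩
      sumBelow P (λ y → Σz (2 ℕ.* y)) ℕ.+ sumBelow P (λ y → Σz (suc (2 ℕ.* y)))
        ≡⟨ cong₂ ℕ._+_ even-y (sumBelow-ones P (λ y → odd-congruence-unique (suc s) c (Odd-1+2* y))) ⟩
      quarterCount c ℕ.+ P ℕ.* 𝟙[ 2 ∣ c ] ℕ.+ P                             ∎
      where
      Σz : ℕ → ℕ
      Σz y = sumBelow N λ z → 𝟙[ N ∣ + y * + z - c ]
      even-even : ∀ y z c → + 2 * y * (+ 2 * z) - c ≡ + 4 * (y * z) - c
      even-even = solve-∀
      even-odd : ∀ y z c → + 2 * y * z - c ≡ + 2 * (z * y) - c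
      even-odd = solve-∀
      even-y : sumBelow P (λ y → Σz (2 ℕ.* y)) ≡ quarterCount c ℕ.+ P ℕ.* 𝟙[ 2 ∣ c ]
      even-y = begin
        sumBelow P (λ y → Σz (2 ℕ.* y))
          ≡⟨ sumBelow-cong P (λ y → sumBelow-evens-odds P _) ⟩
        sumBelow P (λ y → sumBelow P (λ z → 𝟙[ N ∣ + (2 ℕ.* y) * + (2 ℕ.* z) - c ])
                    ℕ.+ sumBelow P (λ z → 𝟙[ N ∣ + (2 ℕ.* y) * + suc (2 ℕ.* z) - c ]))
          ≡⟨ sumBelow-+ P _ _ ⟩
        (sumBelow P λ y → sumBelow P λ z → 𝟙[ N ∣ + (2 ℕ.* y) * + (2 ℕ.* z) - c ])
          ℕ.+ (sumBelow P λ y → sumBelow P λ z → 𝟙[ N ∣ + (2 ℕ.* y) * + suc (2 ℕ.* z) - c ])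
          ≡⟨ cong₂ ℕ._+_ (sumBelow-cong P λ y → sumBelow-cong P λ z → cong 𝟙[ N ∣_]
                             (trans (cong₂ (λ a b → a * b - c) (+2* y) (+2* z)) (even-even (+ y) (+ z) c)))
                         (sumBelow-swap P P _) ⟩
        quarterCount c ℕ.+ (sumBelow P λ z → sumBelow P λ y → 𝟙[ N ∣ + (2 ℕ.* y) * + suc (2 ℕ.* z) - c ])
          ≡⟨ cong (quarterCount c ℕ.+_) (trans (sumBelow-cong P λ z → trans
                (sumBelow-cong P λ y → cong 𝟙[ N ∣_] (trans (cong (λ a → a * + suc (2 ℕ.* z) - c) (+2* y)) (even-odd (+ y) _ c)))
                (even-congruence-count s c (Odd-1+2* z)))
              (sumBelow-const P 𝟙[ 2 ∣ c ])) ⟩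
        quarterCount c ℕ.+ P ℕ.* 𝟙[ 2 ∣ c ] ∎

    squares-parity-count : ∀ m → sumBelow N (λ x → 𝟙[ 2 ∣ + x * + x + m ]) ≡ P
    squares-parity-count m = begin
      sumBelow N (λ x → 𝟙[ 2 ∣ + x * + x + m ])
        ≡⟨ sumBelow-evens-odds P _ ⟩
      sumBelow P (λ x → 𝟙[ 2 ∣ + (2 ℕ.* x) * + (2 ℕ.* x) + m ]) ℕ.+ sumBelow P (λ x → 𝟙[ 2 ∣ + suc (2 ℕ.* x) * + suc (2 ℕ.* x) + m ])
        ≡⟨ cong₂ ℕ._+_ (trans (sumBelow-cong P λ x → 𝟙-cong (even-square x)) (sumBelow-const P _))
                       (trans (sumBelow-cong P λ x → 𝟙-cong (odd-square x)) (sumBelow-const P _)) ⟩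
      P ℕ.* 𝟙[ 2 ∣ m ] ℕ.+ P ℕ.* 𝟙[ 2 ∣ m + + 1 ]   ≡⟨ ℕ.*-distribˡ-+ P _ _ ⟨
      P ℕ.* (𝟙[ 2 ∣ m ] ℕ.+ 𝟙[ 2 ∣ m + + 1 ])       ≡⟨ cong (P ℕ.*_) (𝟙-2-consecutive m) ⟩
      P ℕ.* 1                                       ≡⟨ ℕ.*-identityʳ P ⟩
      P                                             ∎
      where
      even-identity : ∀ x m → + 2 * x * (+ 2 * x) + m - m ≡ (+ 2 * x * x) * + 2
      even-identity = solve-∀
      odd-identity : ∀ x m → (+ 1 + + 2 * x) * (+ 1 + + 2 * x) + m - (m + + 1) ≡ (+ 2 * x + + 2 * x * x) * + 2
      odd-identity = solve-∀
      even-square : ∀ x → + (2 ℕ.* x) * + (2 ℕ.* x) + m ≡ m mod 2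
      even-square x = mod-≡ (+ 2 * + x * + x) (trans (cong (λ a → a * a + m - m) (+2* x)) (even-identity (+ x) m))
      odd-square : ∀ x → + suc (2 ℕ.* x) * + suc (2 ℕ.* x) + m ≡ m + + 1 mod 2
      odd-square x = mod-≡ (+ 2 * + x + + 2 * + x * + x) (trans (cong (λ a → a * a + m - (m + + 1)) (+1+2* x)) (odd-identity (+ x) m))

    quarterCount-periodic : ∀ c →
      (sumBelow N λ y → sumBelow N λ z → 𝟙[ N ∣ + 4 * (+ y * + z) - c ]) ≡ 2 ℕ.* (2 ℕ.* quarterCount c)
    quarterCount-periodic c = sumBelow²-periodic 1 1 P (λ y z → 𝟙[ N ∣ + 4 * (+ y * + z) - c ])
      (λ z → 𝟙-periodic N P (λ a → + 4 * (a * + z) - c)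
               (λ a → mod-≡ (+ 2 * + z) (trans (shift-y (+ P) a (+ z) c) (cong ((+ 2 * + z) *_) (sym (+2* P))))))
      (λ y → 𝟙-periodic N P (λ a → + 4 * (+ y * a) - c)
               (λ a → mod-≡ (+ 2 * + y) (trans (shift-z (+ P) (+ y) a c) (cong ((+ 2 * + y) *_) (sym (+2* P))))))
      where
      shift-y : ∀ P y z c → (+ 4 * ((P + y) * z) - c) - (+ 4 * (y * z) - c) ≡ (+ 2 * z) * (+ 2 * P)
      shift-y = solve-∀
      shift-z : ∀ P y z c → (+ 4 * (y * (P + z)) - c) - (+ 4 * (y * z) - c) ≡ (+ 2 * y) * (+ 2 * P)
      shift-z = solve-∀

    count₁-suc : ∀ m → 4 ℕ.* count₁ m (suc s) ≡ 12 ℕ.* (P ℕ.* P) ℕ.+ count₄ m (suc s)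
    count₁-suc m = begin
      4 ℕ.* count₁ m (suc s)
        ≡⟨ cong (4 ℕ.*_) (sumBelow-cong N (λ x → productCount-split (rhs x))) ⟩
      4 ℕ.* sumBelow N (λ x → quarterCount (rhs x) ℕ.+ P ℕ.* 𝟙[ 2 ∣ rhs x ] ℕ.+ P)
        ≡⟨ cong (4 ℕ.*_) (trans (sumBelow-+ N _ _) (cong₂ ℕ._+_ (trans (sumBelow-+ N _ _)
             (cong (ΣA ℕ.+_) (trans (sumBelow-*ˡ N P _) (cong (P ℕ.*_) (squares-parity-count m))))) (sumBelow-const N P))) ⟩
      4 ℕ.* (ΣA ℕ.+ P ℕ.* P ℕ.+ N ℕ.* P)
        ≡⟨ rearrange ΣA P ⟩
      12 ℕ.* (P ℕ.* P) ℕ.+ 2 ℕ.* (2 ℕ.* ΣA)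
        ≡⟨ cong (12 ℕ.* (P ℕ.* P) ℕ.+_) (sym (trans (sumBelow-cong N (λ x → quarterCount-periodic (rhs x)))
              (trans (sumBelow-*ˡ N 2 _) (cong (2 ℕ.*_) (sumBelow-*ˡ N 2 _))))) ⟩
      12 ℕ.* (P ℕ.* P) ℕ.+ count₄ m (suc s) ∎
      where
      rhs : ℕ → ℤ
      rhs x = + x * + x + m
      ΣA = sumBelow N (λ x → quarterCount (rhs x))
      rearrange : ∀ A P → 4 ℕ.* (A ℕ.+ P ℕ.* P ℕ.+ 2 ℕ.* P ℕ.* P) ≡ 12 ℕ.* (P ℕ.* P) ℕ.+ 2 ℕ.* (2 ℕ.* A)
      rearrange = ℕ-Solver.solve-∀

  count₄-recursion : ∀ m s → count₄ (+ 4 * m) (3 ℕ.+ s) ≡ 96 ℕ.* (2 ^ s ℕ.* 2 ^ s) ℕ.+ 8 ℕ.* count₄ m (suc s)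
  count₄-recursion m s = begin
    count₄ (+ 4 * m) (3 ℕ.+ s)                             ≡⟨ count₄-4* m (suc s) ⟩
    32 ℕ.* count₁ m (suc s)                                ≡⟨ ℕ.*-assoc 8 4 (count₁ m (suc s)) ⟩
    8 ℕ.* (4 ℕ.* count₁ m (suc s))                         ≡⟨ cong (8 ℕ.*_) (count₁-suc s m) ⟩
    8 ℕ.* (12 ℕ.* (2 ^ s ℕ.* 2 ^ s) ℕ.+ count₄ m (suc s))   ≡⟨ distribute (2 ^ s ℕ.* 2 ^ s) (count₄ m (suc s)) ⟩
    96 ℕ.* (2 ^ s ℕ.* 2 ^ s) ℕ.+ 8 ℕ.* count₄ m (suc s)     ∎
    where
    distribute : ∀ A B → 8 ℕ.* (12 ℕ.* A ℕ.+ B) ≡ 96 ℕ.* A ℕ.+ 8 ℕ.* B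
    distribute = ℕ-Solver.solve-∀

module ProductCounts where

  open Sums
  open Congruences
  open TwoAdicCounts
  open Reindexing

  open import Data.Nat as ℕ using (ℕ; suc; _^_)
  import Data.Nat.Properties as ℕ
  import Data.Nat.Tactic.RingSolver as ℕ-Solver
  open import Data.Integer using (ℤ; +_; -_; _+_; _-_; _*_)
  import Data.Integer.Properties as ℤ
  open import Data.Integer.DivMod using (_%ℕ_; n%ℕd<d)
  open import Data.Integer.Tactic.RingSolver using (solve-∀)
  open import Data.Product using (_,_)
  open import Relation.Binary.PropositionalEquality

  productCount-≡ : ∀ s {c c′} → c ≡ c′ mod 2 ^ s → productCount s c ≡ productCount s c′
  productCount-≡ s {c} {c′} c≡c′ = sumBelow-cong (2 ^ s) λ y → sumBelow-cong (2 ^ s) λ z →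
    𝟙-cong (≡mod-+ (≡mod-refl (+ y * + z)) (≡mod-neg c≡c′))

  module _ (s : ℕ) where
    private
      N = 2 ^ s
      instance
        N≢0 : ℕ.NonZero N
        N≢0 = ℕ.m^n≢0 2 s

    mulMod : ℤ → ℕ → ℕ
    mulMod u z = (+ z * u) %ℕ N

    mulMod-inverse : ∀ {u w} → u * w ≡ + 1 mod N → ∀ z → z ℕ.< N → mulMod w (mulMod u z) ≡ z
    mulMod-inverse {u} {w} uw≡1 z z<N = residue-unique (n%ℕd<d (+ mulMod u z * w) N) z<N (begin
      + mulMod w (mulMod u z)   ≈⟨ ≡mod-residue N (+ mulMod u z * w) ⟩
      + mulMod u z * w          ≈⟨ ≡mod-* (≡mod-residue N (+ z * u)) (≡mod-refl w) ⟩
      + z * u * w               ≡⟨ ℤ.*-assoc (+ z) u w ⟩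
      + z * (u * w)             ≈⟨ ≡mod-*ˡ (+ z) uw≡1 ⟩
      + z * + 1                 ≡⟨ ℤ.*-identityʳ (+ z) ⟩
      + z                       ∎)
      where open ≡mod-Reasoning N

    mulMod-≡ : ∀ u y z c → u * (+ y * + z - c) ≡ + y * + mulMod u z - c * u mod N
    mulMod-≡ u y z c = begin
      u * (+ y * + z - c)           ≡⟨ regroup u (+ y) (+ z) c ⟩
      + y * (+ z * u) - c * u       ≈⟨ ≡mod-+ (≡mod-*ˡ (+ y) (≡mod-sym (≡mod-residue N (+ z * u)))) (≡mod-refl (- (c * u))) ⟩
      + y * + mulMod u z - c * u    ∎
      where
      open ≡mod-Reasoning N
      regroup : ∀ u y z c → u * (y * z - c) ≡ y * (z * u) - c * u
      regroup = solve-∀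

    productCount-*-odd : ∀ c {u} → Odd u → productCount s (c * u) ≡ productCount s c
    productCount-*-odd c {u} odd-u with odd-invertible s odd-u
    ... | w , uw≡1 = sumBelow-cong N λ y → sym (begin
      sumBelow N (λ z → 𝟙[ N ∣ + y * + z - c ])                   ≡⟨ sumBelow-cong N (scale y) ⟩
      sumBelow N (λ z → 𝟙[ N ∣ + y * + mulMod u z - c * u ])      ≡⟨ Reindex¹.Sum-bijection N (mulMod u) (mulMod w)
                                                                        (λ z _ → n%ℕd<d (+ z * u) N) (λ z _ → n%ℕd<d (+ z * w) N)
                                                                        (mulMod-inverse uw≡1) (mulMod-inverse wu≡1) _ ⟩
      sumBelow N (λ z → 𝟙[ N ∣ + y * + z - c * u ])               ∎)
      where
      open ≡-Reasoning
      wu≡1 : w * u ≡ + 1 mod N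
      wu≡1 = subst (λ a → a ≡ + 1 mod N) (ℤ.*-comm u w) uw≡1
      scale : ∀ y z → 𝟙[ N ∣ + y * + z - c ] ≡ 𝟙[ N ∣ + y * + mulMod u z - c * u ]
      scale y z = trans (sym (𝟙-unit w u (+ y * + z - c) wu≡1)) (𝟙-cong (mulMod-≡ u y z c))

  Σ-productCount-even : ∀ s →
    sumBelow (2 ^ s) (λ v → productCount (suc s) (+ 2 * + v)) ≡ 3 ℕ.* (2 ^ s ℕ.* 2 ^ s)
  Σ-productCount-even s = begin
    sumBelow P (λ v → sumBelow M λ y → sumBelow M λ z → 𝟙[ M ∣ + y * + z - + 2 * + v ])
      ≡⟨ trans (sumBelow-swap P M _) (sumBelow-cong M (λ y → sumBelow-swap P M _)) ⟩
    (sumBelow M λ y → sumBelow M λ z → sumBelow P λ v → 𝟙[ M ∣ + y * + z - + 2 * + v ])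
      ≡⟨ (sumBelow-cong M λ y → sumBelow-cong M λ z →
           trans (sumBelow-cong P λ v → trans (cong 𝟙[ M ∣_] (flip (+ y * + z) (+ v))) (𝟙-neg M (+ 2 * (+ 1 * + v) - + y * + z)))
                 (even-congruence-count s (+ y * + z) (+ 0 , refl))) ⟩
    (sumBelow M λ y → sumBelow M λ z → 𝟙[ 2 ∣ + y * + z ])
      ≡⟨ even-product-count s ⟩
    3 ℕ.* (P ℕ.* P) ∎
    where
    open ≡-Reasoning
    P = 2 ^ s
    M = 2 ^ suc s
    flip : ∀ a v → a - + 2 * v ≡ - (+ 2 * (+ 1 * v) - a)
    flip = solve-∀

  -- w(w + r) is an odd multiple of 2v, where v = w′ if w = 2w′ and v = w′ + 1 + c₀ if w = 2w′ + 1.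
  Σ-productCount-w[w+r] : ∀ s c₀ → let r = + 1 + + 2 * + c₀ in
    sumBelow (2 ^ suc s) (λ w → productCount (suc s) (+ w * (+ w + r))) ≡ 6 ℕ.* (2 ^ s ℕ.* 2 ^ s)
  Σ-productCount-w[w+r] s c₀ = begin
    sumBelow (2 ℕ.* P) (λ w → productCount (suc s) (+ w * (+ w + r)))
      ≡⟨ sumBelow-evens-odds P _ ⟩
    sumBelow P (λ w → productCount (suc s) (+ (2 ℕ.* w) * (+ (2 ℕ.* w) + r)))
      ℕ.+ sumBelow P (λ w → productCount (suc s) (+ suc (2 ℕ.* w) * (+ suc (2 ℕ.* w) + r)))
      ≡⟨ cong₂ ℕ._+_ (sumBelow-cong P even-w) (trans (sumBelow-cong P odd-w) (sumBelow-rotate P (suc c₀) F F-periodic)) ⟩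
    sumBelow P F ℕ.+ sumBelow P F
      ≡⟨ cong₂ ℕ._+_ (Σ-productCount-even s) (Σ-productCount-even s) ⟩
    3 ℕ.* (P ℕ.* P) ℕ.+ 3 ℕ.* (P ℕ.* P)
      ≡⟨ double (P ℕ.* P) ⟩
    6 ℕ.* (P ℕ.* P) ∎
    where
    open ≡-Reasoning
    P = 2 ^ s
    r = + 1 + + 2 * + c₀
    F : ℕ → ℕ
    F v = productCount (suc s) (+ 2 * + v)
    double : ∀ X → 3 ℕ.* X ℕ.+ 3 ℕ.* X ≡ 6 ℕ.* X
    double = ℕ-Solver.solve-∀
    even-unit : ∀ w c₀ → + 2 * w + (+ 1 + + 2 * c₀) ≡ + 1 + (w + c₀) * + 2
    even-unit = solve-∀
    odd-factor : ∀ w c₀ → (+ 1 + + 2 * w) * ((+ 1 + + 2 * w) + (+ 1 + + 2 * c₀)) ≡ + 2 * (w + (+ 1 + c₀)) * (+ 1 + + 2 * w)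
    odd-factor = solve-∀
    period : ∀ P v → + 2 * (P + v) - + 2 * v ≡ + 1 * (+ 2 * P)
    period = solve-∀
    even-w : ∀ w → productCount (suc s) (+ (2 ℕ.* w) * (+ (2 ℕ.* w) + r)) ≡ F w
    even-w w = begin
      productCount (suc s) (+ (2 ℕ.* w) * (+ (2 ℕ.* w) + r)) ≡⟨ cong (λ a → productCount (suc s) (a * (a + r))) (+2* w) ⟩
      productCount (suc s) (+ 2 * + w * (+ 2 * + w + r))     ≡⟨ productCount-*-odd (suc s) (+ 2 * + w) (+ w + + c₀ , even-unit (+ w) (+ c₀)) ⟩
      F w                                                     ∎
    odd-w : ∀ w → productCount (suc s) (+ suc (2 ℕ.* w) * (+ suc (2 ℕ.* w) + r)) ≡ F (w ℕ.+ suc c₀)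
    odd-w w = begin
      productCount (suc s) (+ suc (2 ℕ.* w) * (+ suc (2 ℕ.* w) + r))
        ≡⟨ cong (λ a → productCount (suc s) (a * (a + r))) (+1+2* w) ⟩
      productCount (suc s) ((+ 1 + + 2 * + w) * ((+ 1 + + 2 * + w) + r))
        ≡⟨ cong (productCount (suc s)) (odd-factor (+ w) (+ c₀)) ⟩
      productCount (suc s) (+ 2 * (+ w + (+ 1 + + c₀)) * (+ 1 + + 2 * + w))
        ≡⟨ productCount-*-odd (suc s) (+ 2 * (+ w + (+ 1 + + c₀))) (subst Odd (+1+2* w) (Odd-1+2* w)) ⟩
      F (w ℕ.+ suc c₀) ∎
    F-periodic : Periodic P F
    F-periodic v = productCount-≡ (suc s) (mod-≡ (+ 1) (trans (period (+ P) (+ v)) (cong (+ 1 *_) (sym (+2* P)))))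

module BaseCases where

  open Sums
  open Congruences
  open TwoAdicCounts
  open Reindexing
  open TargetCount
  open ProductCounts

  open import Data.Nat as ℕ using (ℕ; zero; suc; _^_)
  import Data.Nat.Properties as ℕ
  import Data.Nat.Divisibility as ℕ
  import Data.Nat.Tactic.RingSolver as ℕ-Solver
  open import Data.Integer using (ℤ; +_; -_; _+_; _-_; _*_)
  import Data.Integer.Properties as ℤ
  open import Data.Integer.Divisibility.Signed
  open import Data.Integer.Tactic.RingSolver using (solve-∀)
  open import Data.Product using (Σ; _,_)
  open import Data.Sum using (inj₁; inj₂)
  open import Relation.Nullary using (¬_)
  open import Relation.Binary.PropositionalEquality
  open ≡-Reasoning

  +2^-+ : ∀ i j → + (2 ^ (i ℕ.+ j)) ≡ + (2 ^ i) * + (2 ^ j)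
  +2^-+ i j = trans (cong +_ (ℕ.^-distribˡ-+-* 2 i j)) (ℤ.pos-* (2 ^ i) (2 ^ j))

  -- Hensel lifting: if 2^(3+j) ∣ r² + k but 2^(4+j) ∤ r² + k, then 2^(4+j) ∣ (r + 2^(j+2))² + k.
  odd-square-root : ∀ q j → Σ ℕ λ c₀ → let r = + 1 + + 2 * + c₀ in + (2 ^ (3 ℕ.+ j)) ∣ r * r + + (7 ℕ.+ q ℕ.* 8)
  odd-square-root q zero = 0 , divides (+ 1 + + q) (begin
    + 1 * + 1 + + (7 ℕ.+ q ℕ.* 8)   ≡⟨ cong (_+_ (+ 1 * + 1)) (trans (ℤ.pos-+ 7 (q ℕ.* 8)) (cong (_+_ (+ 7)) (ℤ.pos-* q 8))) ⟩
    + 1 * + 1 + (+ 7 + + q * + 8)    ≡⟨ base (+ q) ⟩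
    (+ 1 + + q) * + 8                ∎)
    where
    base : ∀ q → + 1 * + 1 + (+ 7 + q * + 8) ≡ (+ 1 + q) * + 8
    base = solve-∀
  odd-square-root q (suc j) with odd-square-root q j
  ... | c₀ , divides Q r²+k≡ with parity Q
  ...   | inj₁ (divides a Q≡) = c₀ , divides a (begin
          r * r + k                        ≡⟨ r²+k≡ ⟩
          Q * + (2 ^ (3 ℕ.+ j))            ≡⟨ cong₂ _*_ Q≡ (+2^-+ 3 j) ⟩
          a * + 2 * (+ 8 * + (2 ^ j))      ≡⟨ regroup a (+ (2 ^ j)) ⟩
          a * (+ 16 * + (2 ^ j))           ≡⟨ cong (a *_) (+2^-+ 4 j) ⟨
          a * + (2 ^ (4 ℕ.+ j))            ∎)
    where
    r = + 1 + + 2 * + c₀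
    k = + (7 ℕ.+ q ℕ.* 8)
    regroup : ∀ a P → a * + 2 * (+ 8 * P) ≡ a * (+ 16 * P)
    regroup = solve-∀
  ...   | inj₂ (a , Q≡) = c₀ ℕ.+ 2 ℕ.* 2 ^ j , divides (+ 1 + a + + c₀ + + (2 ^ j)) (begin
          r′ * r′ + k
            ≡⟨ cong (λ t → (+ 1 + + 2 * t) * (+ 1 + + 2 * t) + k) (cong (_+_ (+ c₀)) (+2* (2 ^ j))) ⟩
          (+ 1 + + 2 * (+ c₀ + + 2 * P)) * (+ 1 + + 2 * (+ c₀ + + 2 * P)) + k
            ≡⟨ expand (+ c₀) P k ⟩
          (r * r + k) + + 8 * P * r + + 16 * P * P
            ≡⟨ cong (λ t → t + + 8 * P * r + + 16 * P * P) (trans r²+k≡ (cong₂ _*_ Q≡ (+2^-+ 3 j))) ⟩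
          (+ 1 + a * + 2) * (+ 8 * P) + + 8 * P * r + + 16 * P * P
            ≡⟨ collect (+ c₀) P a ⟩
          (+ 1 + a + + c₀ + P) * (+ 16 * P)
            ≡⟨ cong ((+ 1 + a + + c₀ + P) *_) (+2^-+ 4 j) ⟨
          (+ 1 + a + + c₀ + P) * + (2 ^ (4 ℕ.+ j)) ∎)
    where
    P = + (2 ^ j)
    r = + 1 + + 2 * + c₀
    r′ = + 1 + + 2 * + (c₀ ℕ.+ 2 ℕ.* 2 ^ j)
    k = + (7 ℕ.+ q ℕ.* 8)
    expand : ∀ c P k → (+ 1 + + 2 * (c + + 2 * P)) * (+ 1 + + 2 * (c + + 2 * P)) + k
                        ≡ ((+ 1 + + 2 * c) * (+ 1 + + 2 * c) + k) + + 8 * P * (+ 1 + + 2 * c) + + 16 * P * P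
    expand = solve-∀
    collect : ∀ c P a → (+ 1 + a * + 2) * (+ 8 * P) + + 8 * P * (+ 1 + + 2 * c) + + 16 * P * P ≡ (+ 1 + a + c + P) * (+ 16 * P)
    collect = solve-∀

  4∤4A-j : ∀ P A j → ¬ 4 ℕ.∣ j → ¬ (+ (2 ℕ.* (2 ℕ.* P)) ∣ + 4 * A - + j)
  4∤4A-j P A j 4∤j 4P∣ = 4∤j (∣⇒∣ᵤ (subst (_ ∣_) (cancel (+ 4 * A) (+ j)) (∣m∣n⇒∣m-n (divides A (ℤ.*-comm (+ 4) A)) 4∣)))
    where
    cancel : ∀ a b → a - (a - b) ≡ b
    cancel = solve-∀
    quadruple : ∀ P → 2 ℕ.* (2 ℕ.* P) ≡ P ℕ.* 4
    quadruple = ℕ-Solver.solve-∀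
    4P≡ : + (2 ℕ.* (2 ℕ.* P)) ≡ + P * + 4
    4P≡ = trans (cong +_ (quadruple P)) (ℤ.pos-* P 4)
    4∣ : + 4 ∣ + 4 * A - + j
    4∣ = ∣-trans (divides (+ P) 4P≡) 4P∣

  count₄-nonsquare : ∀ k s → ¬ 4 ℕ.∣ k → ¬ 4 ℕ.∣ suc k → count₄ (+ k) (suc (suc s)) ≡ 0
  count₄-nonsquare k s 4∤k 4∤k+1 = begin
    count₄ (+ k) (suc (suc s))
      ≡⟨ sumBelow-evens-odds (2 ℕ.* P) _ ⟩
    sumBelow (2 ℕ.* P) (λ x → Σyz (2 ℕ.* x)) ℕ.+ sumBelow (2 ℕ.* P) (λ x → Σyz (suc (2 ℕ.* x)))
      ≡⟨ cong₂ ℕ._+_ (sumBelow-vanish (2 ℕ.* P) λ x → sumBelow-vanish N λ y → sumBelow-vanish N λ z → even-x x y z)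
                     (sumBelow-vanish (2 ℕ.* P) λ x → sumBelow-vanish N λ y → sumBelow-vanish N λ z → odd-x x y z) ⟩
    0 ∎
    where
    P = 2 ^ s
    N = 2 ℕ.* (2 ℕ.* P)
    Σyz = count₄ˣ (+ k) (suc (suc s))
    even-form : ∀ y z x k → + 4 * (y * z) - (+ 2 * x * (+ 2 * x) + k) ≡ + 4 * (y * z - x * x) - k
    even-form = solve-∀
    odd-form : ∀ y z x k → + 4 * (y * z) - ((+ 1 + + 2 * x) * (+ 1 + + 2 * x) + k) ≡ + 4 * (y * z - x * x - x) - (+ 1 + k)
    odd-form = solve-∀
    even-x : ∀ x y z → 𝟙[ N ∣ + 4 * (+ y * + z) - (+ (2 ℕ.* x) * + (2 ℕ.* x) + + k) ] ≡ 0
    even-x x y z = trans (cong (λ a → 𝟙[ N ∣ + 4 * (+ y * + z) - (a * a + + k) ]) (+2* x))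
      (trans (cong 𝟙[ N ∣_] (even-form (+ y) (+ z) (+ x) (+ k))) (𝟙-∤ (4∤4A-j P (+ y * + z - + x * + x) k 4∤k)))
    odd-x : ∀ x y z → 𝟙[ N ∣ + 4 * (+ y * + z) - (+ suc (2 ℕ.* x) * + suc (2 ℕ.* x) + + k) ] ≡ 0
    odd-x x y z = trans (cong (λ a → 𝟙[ N ∣ + 4 * (+ y * + z) - (a * a + + k) ]) (+1+2* x))
      (trans (cong 𝟙[ N ∣_] (odd-form (+ y) (+ z) (+ x) (+ k))) (𝟙-∤ (4∤4A-j P (+ y * + z - + x * + x - + x) (suc k) 4∤k+1)))

  even-x-vanish : ∀ Q {k} → Odd k → ∀ x y z → 𝟙[ 2 ℕ.* Q ∣ + 4 * (+ y * + z) - (+ (2 ℕ.* x) * + (2 ℕ.* x) + k) ] ≡ 0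
  even-x-vanish Q {k} odd-k x y z = begin
    𝟙[ 2 ℕ.* Q ∣ + 4 * (+ y * + z) - (+ (2 ℕ.* x) * + (2 ℕ.* x) + k) ]
      ≡⟨ cong (λ a → 𝟙[ 2 ℕ.* Q ∣ + 4 * (+ y * + z) - (a * a + k) ]) (+2* x) ⟩
    𝟙[ 2 ℕ.* Q ∣ + 4 * (+ y * + z) - (+ 2 * + x * (+ 2 * + x) + k) ]
      ≡⟨ cong 𝟙[ 2 ℕ.* Q ∣_] (factor (+ y) (+ z) (+ x) k) ⟩
    𝟙[ 2 ℕ.* Q ∣ + 2 * (+ 2 * (+ y * + z - + x * + x)) - k ]
      ≡⟨ 𝟙-odd Q (2∤2*-odd (+ 2 * (+ y * + z - + x * + x)) odd-k) ⟩
    0 ∎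
    where
    factor : ∀ y z x k → + 4 * (y * z) - (+ 2 * x * (+ 2 * x) + k) ≡ + 2 * (+ 2 * (y * z - x * x)) - k
    factor = solve-∀

  Odd-1+2j+8q : ∀ j q → Odd (+ (suc (2 ℕ.* j) ℕ.+ q ℕ.* 8))
  Odd-1+2j+8q j q = + j + + q * + 4 , (begin
    + (suc (2 ℕ.* j) ℕ.+ q ℕ.* 8)     ≡⟨ ℤ.pos-+ (suc (2 ℕ.* j)) (q ℕ.* 8) ⟩
    + suc (2 ℕ.* j) + + (q ℕ.* 8)     ≡⟨ cong₂ _+_ (+1+2* j) (ℤ.pos-* q 8) ⟩
    + 1 + + 2 * + j + + q * + 8       ≡⟨ regroup (+ j) (+ q) ⟩
    + 1 + (+ j + + q * + 4) * + 2     ∎)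
    where
    regroup : ∀ j q → + 1 + + 2 * j + q * + 8 ≡ + 1 + (j + q * + 4) * + 2
    regroup = solve-∀

  module _ (q s : ℕ) where
    private
      P = 2 ^ s
      M = 2 ℕ.* P
      Q = 2 ℕ.* M
      N = 2 ℕ.* Q
      k = 3 ℕ.+ q ℕ.* 8

    -- For odd x = 1 + 2w, (4yz − x² − k)/4 = yz − w(w + 1) − 1 − 2q with odd right-hand side.
    3-mod-8-odd-slice : ∀ w → count₄ˣ (+ k) (3 ℕ.+ s) (suc (2 ℕ.* w)) ≡ 2^ 2 · 2^ 2 · P
    3-mod-8-odd-slice w = begin
      count₄ˣ (+ k) (3 ℕ.+ s) (suc (2 ℕ.* w))
        ≡⟨ (sumBelow-cong N λ y → sumBelow-cong N λ z → begin
             𝟙[ N ∣ + 4 * (+ y * + z) - (+ suc (2 ℕ.* w) * + suc (2 ℕ.* w) + + k) ]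
               ≡⟨ cong₂ (λ a b → 𝟙[ N ∣ + 4 * (+ y * + z) - (a * a + b) ]) (+1+2* w) +k≡ ⟩
             𝟙[ N ∣ + 4 * (+ y * + z) - ((+ 1 + + 2 * + w) * (+ 1 + + 2 * + w) + (+ 3 + + q * + 8)) ]
               ≡⟨ cong 𝟙[ N ∣_] (quarter (+ y) (+ z) (+ w) (+ q)) ⟩
             𝟙[ 2 ℕ.* Q ∣ + 2 * (+ 2 * (+ y * + z - rhs)) ]
               ≡⟨ trans (𝟙-double Q (+ 2 * (+ y * + z - rhs))) (𝟙-double M (+ y * + z - rhs)) ⟩
             𝟙[ M ∣ + y * + z - rhs ] ∎) ⟩
      (sumBelow (2^ 2 · M) λ y → sumBelow (2^ 2 · M) λ z → 𝟙[ M ∣ + y * + z - rhs ])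
        ≡⟨ sumBelow²-periodic 2 2 M (λ y z → 𝟙[ M ∣ + y * + z - rhs ]) (𝟙[yz-c]-periodicʸ M rhs) (𝟙[yz-c]-periodicᶻ M rhs) ⟩
      2^ 2 · 2^ 2 · productCount (suc s) rhs
        ≡⟨ cong (2^ 2 ·_) (cong (2^ 2 ·_) (odd-product-count s odd-rhs)) ⟩
      2^ 2 · 2^ 2 · P ∎
      where
      rhs = + w * (+ w + + 1) + + 1 + + q * + 2
      +k≡ : + k ≡ + 3 + + q * + 8
      +k≡ = trans (ℤ.pos-+ 3 (q ℕ.* 8)) (cong (_+_ (+ 3)) (ℤ.pos-* q 8))
      quarter : ∀ y z w q → + 4 * (y * z) - ((+ 1 + + 2 * w) * (+ 1 + + 2 * w) + (+ 3 + q * + 8))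
                              ≡ + 2 * (+ 2 * (y * z - (w * (w + + 1) + + 1 + q * + 2)))
      quarter = solve-∀
      regroup : ∀ e q → e * + 2 + + 1 + q * + 2 ≡ + 1 + (e + q) * + 2
      regroup = solve-∀
      odd-rhs : Odd rhs
      odd-rhs with 2∣n[n+1] (+ w)
      ... | divides e e≡ = e + + q , trans (cong (λ a → a + + 1 + + q * + 2) e≡) (regroup e (+ q))

    count₄-3-mod-8 : count₄ (+ k) (3 ℕ.+ s) ≡ 64 ℕ.* (P ℕ.* P)
    count₄-3-mod-8 = begin
      count₄ (+ k) (3 ℕ.+ s)
        ≡⟨ sumBelow-evens-odds Q _ ⟩
      sumBelow Q (λ x → count₄ˣ (+ k) (3 ℕ.+ s) (2 ℕ.* x)) ℕ.+ sumBelow Q (λ x → count₄ˣ (+ k) (3 ℕ.+ s) (suc (2 ℕ.* x)))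
        ≡⟨ cong₂ ℕ._+_ (sumBelow-vanish Q λ x → sumBelow-vanish N λ y → sumBelow-vanish N λ z → even-x-vanish Q (Odd-1+2j+8q 1 q) x y z)
                       (trans (sumBelow-cong Q 3-mod-8-odd-slice) (sumBelow-const Q _)) ⟩
      0 ℕ.+ Q ℕ.* (2^ 2 · 2^ 2 · P)
        ≡⟨ sixty-four P ⟩
      64 ℕ.* (P ℕ.* P) ∎
      where
      sixty-four : ∀ P → 0 ℕ.+ 2 ℕ.* (2 ℕ.* P) ℕ.* (2 ℕ.* (2 ℕ.* (2 ℕ.* (2 ℕ.* P)))) ≡ 64 ℕ.* (P ℕ.* P)
      sixty-four = ℕ-Solver.solve-∀

  module _ (q s : ℕ) where
    private
      P = 2 ^ s
      M = 2 ℕ.* P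
      Q = 2 ℕ.* M
      N = 2 ℕ.* Q
      k = 7 ℕ.+ q ℕ.* 8

    odd-slice : ℕ → ℕ
    odd-slice x = count₄ˣ (+ k) (3 ℕ.+ s) (suc (2 ℕ.* x))

    odd-slice-periodic : Periodic Q odd-slice
    odd-slice-periodic x = sumBelow-cong N λ y → sumBelow-cong N λ z → 𝟙-cong (shift-x x y z)
      where
      shift : ∀ y z x Q k → (+ 4 * (y * z) - ((+ 1 + + 2 * (Q + x)) * (+ 1 + + 2 * (Q + x)) + k))
                            - (+ 4 * (y * z) - ((+ 1 + + 2 * x) * (+ 1 + + 2 * x) + k)) ≡ - (+ 2 + + 4 * x + + 2 * Q) * (+ 2 * Q)
      shift = solve-∀
      shift-x : ∀ x y z → + 4 * (+ y * + z) - (+ suc (2 ℕ.* (Q ℕ.+ x)) * + suc (2 ℕ.* (Q ℕ.+ x)) + + k)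
                          ≡ + 4 * (+ y * + z) - (+ suc (2 ℕ.* x) * + suc (2 ℕ.* x) + + k) mod N
      shift-x x y z = mod-≡ (- (+ 2 + + 4 * + x + + 2 * + Q)) (begin
        (+ 4 * (+ y * + z) - (+ suc (2 ℕ.* (Q ℕ.+ x)) * + suc (2 ℕ.* (Q ℕ.+ x)) + + k))
          - (+ 4 * (+ y * + z) - (+ suc (2 ℕ.* x) * + suc (2 ℕ.* x) + + k))
          ≡⟨ cong₂ (λ a b → (+ 4 * (+ y * + z) - (a * a + + k)) - (+ 4 * (+ y * + z) - (b * b + + k))) (+1+2* (Q ℕ.+ x)) (+1+2* x) ⟩
        (+ 4 * (+ y * + z) - ((+ 1 + + 2 * (+ Q + + x)) * (+ 1 + + 2 * (+ Q + + x)) + + k))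
          - (+ 4 * (+ y * + z) - ((+ 1 + + 2 * + x) * (+ 1 + + 2 * + x) + + k))
          ≡⟨ shift (+ y) (+ z) (+ x) (+ Q) (+ k) ⟩
        - (+ 2 + + 4 * + x + + 2 * + Q) * (+ 2 * + Q)
          ≡⟨ cong (- (+ 2 + + 4 * + x + + 2 * + Q) *_) (+2* Q) ⟨
        - (+ 2 + + 4 * + x + + 2 * + Q) * + N ∎)

    -- Completing the square: if r = 1 + 2c₀ has r² + k ≡ 0 (mod N), then x = r + 2w gives
    -- 4yz − x² − k ≡ 4(yz − w(w + r)).
    odd-slice-completed : ∀ c₀ R → let r = + 1 + + 2 * + c₀ in r * r + + k ≡ R * + N →
      ∀ w y z → 𝟙[ N ∣ + 4 * (+ y * + z) - (+ suc (2 ℕ.* (w ℕ.+ c₀)) * + suc (2 ℕ.* (w ℕ.+ c₀)) + + k) ]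
                ≡ 𝟙[ M ∣ + y * + z - + w * (+ w + r) ]
    odd-slice-completed c₀ R r²+k≡ w y z = trans (𝟙-cong completed)
      (trans (𝟙-double Q (+ 2 * (+ y * + z - + w * (+ w + r)))) (𝟙-double M (+ y * + z - + w * (+ w + r))))
      where
      r = + 1 + + 2 * + c₀
      D = + 2 * (+ 2 * (+ y * + z - + w * (+ w + r)))
      complete : ∀ y z w c₀ k → (+ 4 * (y * z) - ((+ 1 + + 2 * (w + c₀)) * (+ 1 + + 2 * (w + c₀)) + k))
                                 - + 2 * (+ 2 * (y * z - w * (w + (+ 1 + + 2 * c₀))))
                                 ≡ - ((+ 1 + + 2 * c₀) * (+ 1 + + 2 * c₀) + k)
      complete = solve-∀
      completed : + 4 * (+ y * + z) - (+ suc (2 ℕ.* (w ℕ.+ c₀)) * + suc (2 ℕ.* (w ℕ.+ c₀)) + + k) ≡ D mod N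
      completed = mod-≡ (- R) (begin
        (+ 4 * (+ y * + z) - (+ suc (2 ℕ.* (w ℕ.+ c₀)) * + suc (2 ℕ.* (w ℕ.+ c₀)) + + k)) - D
          ≡⟨ cong (λ a → (+ 4 * (+ y * + z) - (a * a + + k)) - D) (+1+2* (w ℕ.+ c₀)) ⟩
        (+ 4 * (+ y * + z) - ((+ 1 + + 2 * (+ w + + c₀)) * (+ 1 + + 2 * (+ w + + c₀)) + + k)) - D
          ≡⟨ complete (+ y) (+ z) (+ w) (+ c₀) (+ k) ⟩
        - (r * r + + k)         ≡⟨ cong -_ r²+k≡ ⟩
        - (R * + N)             ≡⟨ ℤ.neg-distribˡ-* R (+ N) ⟩
        - R * + N               ∎)

    count₄-7-mod-8 : count₄ (+ k) (3 ℕ.+ s) ≡ 192 ℕ.* (P ℕ.* P)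
    count₄-7-mod-8 with odd-square-root q s
    ... | c₀ , divides R r²+k≡ = begin
      count₄ (+ k) (3 ℕ.+ s)
        ≡⟨ sumBelow-evens-odds Q _ ⟩
      sumBelow Q (λ x → count₄ˣ (+ k) (3 ℕ.+ s) (2 ℕ.* x)) ℕ.+ sumBelow Q odd-slice
        ≡⟨ cong₂ ℕ._+_ (sumBelow-vanish Q λ x → sumBelow-vanish N λ y → sumBelow-vanish N λ z → even-x-vanish Q (Odd-1+2j+8q 3 q) x y z)
                       (sym (sumBelow-rotate Q c₀ odd-slice odd-slice-periodic)) ⟩
      0 ℕ.+ sumBelow Q (λ x → odd-slice (x ℕ.+ c₀))
        ≡⟨ cong (0 ℕ.+_) (sumBelow-cong Q λ w → sumBelow-cong N λ y → sumBelow-cong N λ z → odd-slice-completed c₀ R r²+k≡ w y z) ⟩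
      0 ℕ.+ (sumBelow (2^ 1 · M) λ w → sumBelow (2^ 2 · M) λ y → sumBelow (2^ 2 · M) λ z → g w y z)
        ≡⟨ cong (0 ℕ.+_) (sumBelow³-periodic 1 2 2 M g g-periodicʷ
             (λ w → 𝟙[yz-c]-periodicʸ M (w[w+r] w)) (λ w → 𝟙[yz-c]-periodicᶻ M (w[w+r] w))) ⟩
      0 ℕ.+ 2^ 2 · 2^ 2 · 2^ 1 · sumBelow M (λ w → productCount (suc s) (w[w+r] w))
        ≡⟨ cong (λ X → 0 ℕ.+ 2^ 2 · 2^ 2 · 2^ 1 · X) (Σ-productCount-w[w+r] s c₀) ⟩
      0 ℕ.+ 2^ 2 · 2^ 2 · 2^ 1 · (6 ℕ.* (P ℕ.* P))
        ≡⟨ hundred-ninety-two (P ℕ.* P) ⟩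
      192 ℕ.* (P ℕ.* P) ∎
      where
      r = + 1 + + 2 * + c₀
      w[w+r] : ℕ → ℤ
      w[w+r] w = + w * (+ w + r)
      g : ℕ → ℕ → ℕ → ℕ
      g w y z = 𝟙[ M ∣ + y * + z - w[w+r] w ]
      shift-w : ∀ y z w M r → (y * z - (M + w) * ((M + w) + r)) - (y * z - w * (w + r)) ≡ - (+ 2 * w + M + r) * M
      shift-w = solve-∀
      g-periodicʷ : ∀ y z → Periodic M (λ w → g w y z)
      g-periodicʷ y z = 𝟙-periodic M M (λ a → + y * + z - a * (a + r))
        (λ a → mod-≡ (- (+ 2 * a + + M + r)) (shift-w (+ y) (+ z) a (+ M) r))
      hundred-ninety-two : ∀ X → 0 ℕ.+ 2 ℕ.* (2 ℕ.* (2 ℕ.* (2 ℕ.* (2 ℕ.* (6 ℕ.* X))))) ≡ 192 ℕ.* X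
      hundred-ninety-two = ℕ-Solver.solve-∀

module Equivalence where

  open Congruences
  open TwoAdicCounts
  open Reindexing

  open import Data.Nat as ℕ using (ℕ; suc; _^_)
  import Data.Nat.Properties as ℕ
  open import Data.Integer using (ℤ; +_; -_; _+_; _-_; _*_)
  import Data.Integer.Properties as ℤ
  import Data.Integer.Divisibility as Unsigned
  open import Data.Integer.Divisibility.Signed
  open import Data.Integer.DivMod using (_%ℕ_; n%ℕd<d)
  open import Data.Integer.Tactic.RingSolver using (solve-∀)
  open import Data.Fin using (Fin; zero; suc)
  open import Data.Product using (_,_)
  open import Function using (_∘_)
  open import Relation.Binary.PropositionalEquality

  pattern ₀ = zero
  pattern ₁ = suc zero
  pattern ₂ = suc (suc zero)

  Vec³ : Set
  Vec³ = Fin 3 → ℤ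

  _·_ : Mat3 → Vec³ → Vec³
  (A · v) i = sum3 λ j → A i j * v j

  quad : Mat3 → Vec³ → ℤ
  quad G v = sum3 λ i → sum3 λ j → v i * G i j * v j

  sum3-cong : ∀ {f g : Fin 3 → ℤ} → (∀ i → f i ≡ g i) → sum3 f ≡ sum3 g
  sum3-cong eq = cong₂ _+_ (cong₂ _+_ (eq ₀) (eq ₁)) (eq ₂)

  sum3-*ˡ : ∀ c (f : Fin 3 → ℤ) → c * sum3 f ≡ sum3 (λ i → c * f i)
  sum3-*ˡ c f = distrib c (f ₀) (f ₁) (f ₂)
    where
    distrib : ∀ c a b d → c * (a + b + d) ≡ c * a + c * b + c * d
    distrib = solve-∀

  sum3-*ʳ : ∀ c (f : Fin 3 → ℤ) → sum3 f * c ≡ sum3 (λ i → f i * c)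
  sum3-*ʳ c f = distrib c (f ₀) (f ₁) (f ₂)
    where
    distrib : ∀ c a b d → (a + b + d) * c ≡ a * c + b * c + d * c
    distrib = solve-∀

  sum3-swap : ∀ (F : Fin 3 → Fin 3 → ℤ) → sum3 (λ i → sum3 (F i)) ≡ sum3 (λ j → sum3 (λ i → F i j))
  sum3-swap F = transpose (F ₀ ₀) (F ₀ ₁) (F ₀ ₂) (F ₁ ₀) (F ₁ ₁) (F ₁ ₂) (F ₂ ₀) (F ₂ ₁) (F ₂ ₂)
    where
    transpose : ∀ a b c d e f g h i → (a + b + c) + (d + e + f) + (g + h + i) ≡ (a + d + g) + (b + e + h) + (c + f + i)
    transpose = solve-∀

  sum3-≡mod : ∀ {N} {f g : Fin 3 → ℤ} → (∀ i → f i ≡ g i mod N) → sum3 f ≡ sum3 g mod N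
  sum3-≡mod eq = ≡mod-+ (≡mod-+ (eq ₀) (eq ₁)) (eq ₂)

  bilinear : ∀ (u w : Fin 3 → ℤ) c → sum3 u * c * sum3 w ≡ sum3 λ i → sum3 λ j → u i * c * w j
  bilinear u w c = begin
    sum3 u * c * sum3 w                         ≡⟨ cong (_* sum3 w) (sum3-*ʳ c u) ⟩
    sum3 (λ i → u i * c) * sum3 w               ≡⟨ sum3-*ʳ (sum3 w) (λ i → u i * c) ⟩
    sum3 (λ i → u i * c * sum3 w)               ≡⟨ sum3-cong (λ i → sum3-*ˡ (u i * c) w) ⟩
    sum3 (λ i → sum3 λ j → u i * c * w j)       ∎
    where open ≡-Reasoning

  quad-subst : ∀ G M v → quad G (M · v) ≡ quad (λ i j → sum3 λ k → sum3 λ l → M k i * G k l * M l j) v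
  quad-subst G M v = begin
    (sum3 λ k → sum3 λ l → (M · v) k * G k l * (M · v) l)
      ≡⟨ sum3-cong (λ k → sum3-cong (λ l → bilinear (λ i → M k i * v i) (λ j → M l j * v j) (G k l))) ⟩
    (sum3 λ k → sum3 λ l → sum3 λ i → sum3 λ j → T i j k l)
      ≡⟨ sum3-cong (λ k → sum3-swap (λ l i → sum3 λ j → T i j k l)) ⟩
    (sum3 λ k → sum3 λ i → sum3 λ l → sum3 λ j → T i j k l)
      ≡⟨ sum3-swap (λ k i → sum3 λ l → sum3 λ j → T i j k l) ⟩
    (sum3 λ i → sum3 λ k → sum3 λ l → sum3 λ j → T i j k l)
      ≡⟨ sum3-cong (λ i → sum3-cong (λ k → sum3-swap (λ l j → T i j k l))) ⟩
    (sum3 λ i → sum3 λ k → sum3 λ j → sum3 λ l → T i j k l)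
      ≡⟨ sum3-cong (λ i → sum3-swap (λ k j → sum3 λ l → T i j k l)) ⟩
    (sum3 λ i → sum3 λ j → sum3 λ k → sum3 λ l → T i j k l)
      ≡⟨ sum3-cong (λ i → sum3-cong (λ j → sum3-cong (λ k → sum3-cong (λ l → regroup (M k i) (v i) (G k l) (M l j) (v j))))) ⟩
    (sum3 λ i → sum3 λ j → sum3 λ k → sum3 λ l → v i * (M k i * G k l * M l j) * v j)
      ≡⟨ sum3-cong (λ i → sum3-cong (λ j → sym (bilinear′ (v i) (v j) (λ k l → M k i * G k l * M l j)))) ⟩
    (sum3 λ i → sum3 λ j → v i * (sum3 λ k → sum3 λ l → M k i * G k l * M l j) * v j) ∎
    where
    open ≡-Reasoning
    T : Fin 3 → Fin 3 → Fin 3 → Fin 3 → ℤ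
    T i j k l = M k i * v i * G k l * (M l j * v j)
    regroup : ∀ m a g n b → m * a * g * (n * b) ≡ a * (m * g * n) * b
    regroup = solve-∀
    bilinear′ : ∀ a b (X : Fin 3 → Fin 3 → ℤ) → a * sum3 (λ k → sum3 (X k)) * b ≡ sum3 λ k → sum3 λ l → a * X k l * b
    bilinear′ a b X = begin
      a * sum3 (λ k → sum3 (X k)) * b          ≡⟨ cong (_* b) (sum3-*ˡ a (λ k → sum3 (X k))) ⟩
      sum3 (λ k → a * sum3 (X k)) * b          ≡⟨ sum3-*ʳ b (λ k → a * sum3 (X k)) ⟩
      sum3 (λ k → a * sum3 (X k) * b)
        ≡⟨ sum3-cong (λ k → trans (cong (_* b) (sum3-*ˡ a (X k))) (sum3-*ʳ b (λ l → a * X k l))) ⟩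
      (sum3 λ k → sum3 λ l → a * X k l * b)    ∎

  quad-≡mod : ∀ {N} G H v → (∀ i j → G i j ≡ H i j mod N) → quad G v ≡ quad H v mod N
  quad-≡mod G H v G≡H = sum3-≡mod λ i → sum3-≡mod λ j → ≡mod-* (≡mod-*ˡ (v i) (G≡H i j)) (≡mod-refl (v j))

  evalᵥ : TernaryForm → Vec³ → ℤ
  evalᵥ Q w = eval Q (w ₀) (w ₁) (w ₂)

  2*evalᵥ≡quad-gram : ∀ Q v → + 2 * evalᵥ Q v ≡ quad (gram Q) v
  2*evalᵥ≡quad-gram Q v = expand (a Q) (b Q) (c Q) (d Q) (e Q) (f Q) (v ₀) (v ₁) (v ₂)
    where
    expand : ∀ a b c d e f x y z →
      + 2 * (a * x * x + b * y * y + c * z * z + d * y * z + e * z * x + f * x * y)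
        ≡ (x * (+ 2 * a) * x + x * f * y + x * e * z) + (y * f * x + y * (+ 2 * b) * y + y * d * z)
          + (z * e * x + z * d * y + z * (+ 2 * c) * z)
    expand = solve-∀

  ≡mod-cancel-2 : ∀ t {a b} → + 2 * a ≡ + 2 * b mod 2 ^ suc t → a ≡ b mod 2 ^ t
  ≡mod-cancel-2 t {a} {b} (mod-by d) = mod-by (*-cancelˡ-∣ (+ 2) (subst₂ _∣_ (+2^suc t) (factor a b) d))
    where
    factor : ∀ a b → + 2 * a - + 2 * b ≡ + 2 * (a - b)
    factor = solve-∀

  -- Gram matrices are doubled, so a congruence modulo 2^(t+1) controls the values only modulo 2^t.
  gram-congruent-values : ∀ {F G} t M → (∀ i j → Unsigned._∣_ (+ (2 ^ suc t)) (gramSubst F M i j - gram G i j)) →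
    ∀ v → evalᵥ F (M · v) ≡ evalᵥ G v mod 2 ^ t
  gram-congruent-values {F} {G} t M gram≡ v = ≡mod-cancel-2 t
    (subst₂ (λ p q → p ≡ q mod 2 ^ suc t)
      (sym (trans (2*evalᵥ≡quad-gram F (M · v)) (quad-subst (gram F) M v))) (sym (2*evalᵥ≡quad-gram G v))
      (quad-≡mod (gramSubst F M) (gram G) v (λ i j → mod-by (∣ᵤ⇒∣ (gram≡ i j)))))

  eval-≡mod : ∀ Q {N} {v w : Vec³} → (∀ i → v i ≡ w i mod N) → evalᵥ Q v ≡ evalᵥ Q w mod N
  eval-≡mod Q v≡w =
    ≡mod-+ (≡mod-+ (≡mod-+ (≡mod-+ (≡mod-+ (monomial (a Q) x x) (monomial (b Q) y y)) (monomial (c Q) z z))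
      (monomial (d Q) y z)) (monomial (e Q) z x)) (monomial (f Q) x y)
    where
    x = v≡w ₀
    y = v≡w ₁
    z = v≡w ₂
    monomial : ∀ {N p p′ q q′} k → p ≡ p′ mod N → q ≡ q′ mod N → k * p * q ≡ k * p′ * q′ mod N
    monomial k p≡ q≡ = ≡mod-* (≡mod-*ˡ k p≡) q≡

  adj : Mat3 → Mat3
  adj M ₀ ₀ = M ₁ ₁ * M ₂ ₂ - M ₁ ₂ * M ₂ ₁
  adj M ₀ ₁ = M ₂ ₁ * M ₀ ₂ - M ₂ ₂ * M ₀ ₁
  adj M ₀ ₂ = M ₀ ₁ * M ₁ ₂ - M ₀ ₂ * M ₁ ₁
  adj M ₁ ₀ = M ₁ ₂ * M ₂ ₀ - M ₁ ₀ * M ₂ ₂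
  adj M ₁ ₁ = M ₂ ₂ * M ₀ ₀ - M ₂ ₀ * M ₀ ₂
  adj M ₁ ₂ = M ₀ ₂ * M ₁ ₀ - M ₀ ₀ * M ₁ ₂
  adj M ₂ ₀ = M ₁ ₀ * M ₂ ₁ - M ₁ ₁ * M ₂ ₀
  adj M ₂ ₁ = M ₂ ₀ * M ₀ ₁ - M ₂ ₁ * M ₀ ₀
  adj M ₂ ₂ = M ₀ ₀ * M ₁ ₁ - M ₀ ₁ * M ₁ ₀

  adj-·-· : ∀ M v i → (adj M · (M · v)) i ≡ det3 M * v i
  adj-·-· M v ₀ = cofactor₀ (M ₀ ₀) (M ₀ ₁) (M ₀ ₂) (M ₁ ₀) (M ₁ ₁) (M ₁ ₂) (M ₂ ₀) (M ₂ ₁) (M ₂ ₂) (v ₀) (v ₁) (v ₂)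
    where
    cofactor₀ : ∀ m00 m01 m02 m10 m11 m12 m20 m21 m22 x y z →
      (m11 * m22 - m12 * m21) * (m00 * x + m01 * y + m02 * z)
      + (m21 * m02 - m22 * m01) * (m10 * x + m11 * y + m12 * z)
      + (m01 * m12 - m02 * m11) * (m20 * x + m21 * y + m22 * z)
        ≡ (m00 * (m11 * m22 - m12 * m21) - m01 * (m10 * m22 - m12 * m20) + m02 * (m10 * m21 - m11 * m20)) * x
    cofactor₀ = solve-∀
  adj-·-· M v ₁ = cofactor₁ (M ₀ ₀) (M ₀ ₁) (M ₀ ₂) (M ₁ ₀) (M ₁ ₁) (M ₁ ₂) (M ₂ ₀) (M ₂ ₁) (M ₂ ₂) (v ₀) (v ₁) (v ₂)
    where
    cofactor₁ : ∀ m00 m01 m02 m10 m11 m12 m20 m21 m22 x y z →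
      (m12 * m20 - m10 * m22) * (m00 * x + m01 * y + m02 * z)
      + (m22 * m00 - m20 * m02) * (m10 * x + m11 * y + m12 * z)
      + (m02 * m10 - m00 * m12) * (m20 * x + m21 * y + m22 * z)
        ≡ (m00 * (m11 * m22 - m12 * m21) - m01 * (m10 * m22 - m12 * m20) + m02 * (m10 * m21 - m11 * m20)) * y
    cofactor₁ = solve-∀
  adj-·-· M v ₂ = cofactor₂ (M ₀ ₀) (M ₀ ₁) (M ₀ ₂) (M ₁ ₀) (M ₁ ₁) (M ₁ ₂) (M ₂ ₀) (M ₂ ₁) (M ₂ ₂) (v ₀) (v ₁) (v ₂)
    where
    cofactor₂ : ∀ m00 m01 m02 m10 m11 m12 m20 m21 m22 x y z →
      (m10 * m21 - m11 * m20) * (m00 * x + m01 * y + m02 * z)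
      + (m20 * m01 - m21 * m00) * (m10 * x + m11 * y + m12 * z)
      + (m00 * m11 - m01 * m10) * (m20 * x + m21 * y + m22 * z)
        ≡ (m00 * (m11 * m22 - m12 * m21) - m01 * (m10 * m22 - m12 * m20) + m02 * (m10 * m21 - m11 * m20)) * z
    cofactor₂ = solve-∀

  ·-adj-· : ∀ M v i → (M · (adj M · v)) i ≡ det3 M * v i
  ·-adj-· M v ₀ = cofactorᵀ₀ (M ₀ ₀) (M ₀ ₁) (M ₀ ₂) (M ₁ ₀) (M ₁ ₁) (M ₁ ₂) (M ₂ ₀) (M ₂ ₁) (M ₂ ₂) (v ₀) (v ₁) (v ₂)
    where
    cofactorᵀ₀ : ∀ m00 m01 m02 m10 m11 m12 m20 m21 m22 x y z →
      m00 * ((m11 * m22 - m12 * m21) * x + (m21 * m02 - m22 * m01) * y + (m01 * m12 - m02 * m11) * z)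
      + m01 * ((m12 * m20 - m10 * m22) * x + (m22 * m00 - m20 * m02) * y + (m02 * m10 - m00 * m12) * z)
      + m02 * ((m10 * m21 - m11 * m20) * x + (m20 * m01 - m21 * m00) * y + (m00 * m11 - m01 * m10) * z)
        ≡ (m00 * (m11 * m22 - m12 * m21) - m01 * (m10 * m22 - m12 * m20) + m02 * (m10 * m21 - m11 * m20)) * x
    cofactorᵀ₀ = solve-∀
  ·-adj-· M v ₁ = cofactorᵀ₁ (M ₀ ₀) (M ₀ ₁) (M ₀ ₂) (M ₁ ₀) (M ₁ ₁) (M ₁ ₂) (M ₂ ₀) (M ₂ ₁) (M ₂ ₂) (v ₀) (v ₁) (v ₂)
    where
    cofactorᵀ₁ : ∀ m00 m01 m02 m10 m11 m12 m20 m21 m22 x y z →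
      m10 * ((m11 * m22 - m12 * m21) * x + (m21 * m02 - m22 * m01) * y + (m01 * m12 - m02 * m11) * z)
      + m11 * ((m12 * m20 - m10 * m22) * x + (m22 * m00 - m20 * m02) * y + (m02 * m10 - m00 * m12) * z)
      + m12 * ((m10 * m21 - m11 * m20) * x + (m20 * m01 - m21 * m00) * y + (m00 * m11 - m01 * m10) * z)
        ≡ (m00 * (m11 * m22 - m12 * m21) - m01 * (m10 * m22 - m12 * m20) + m02 * (m10 * m21 - m11 * m20)) * y
    cofactorᵀ₁ = solve-∀
  ·-adj-· M v ₂ = cofactorᵀ₂ (M ₀ ₀) (M ₀ ₁) (M ₀ ₂) (M ₁ ₀) (M ₁ ₁) (M ₁ ₂) (M ₂ ₀) (M ₂ ₁) (M ₂ ₂) (v ₀) (v ₁) (v ₂)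
    where
    cofactorᵀ₂ : ∀ m00 m01 m02 m10 m11 m12 m20 m21 m22 x y z →
      m20 * ((m11 * m22 - m12 * m21) * x + (m21 * m02 - m22 * m01) * y + (m01 * m12 - m02 * m11) * z)
      + m21 * ((m12 * m20 - m10 * m22) * x + (m22 * m00 - m20 * m02) * y + (m02 * m10 - m00 * m12) * z)
      + m22 * ((m10 * m21 - m11 * m20) * x + (m20 * m01 - m21 * m00) * y + (m00 * m11 - m01 * m10) * z)
        ≡ (m00 * (m11 * m22 - m12 * m21) - m01 * (m10 * m22 - m12 * m20) + m02 * (m10 * m21 - m11 * m20)) * z
    cofactorᵀ₂ = solve-∀

  embed : ℕ³ → Vec³
  embed (x , y , z) ₀ = + x
  embed (x , y , z) ₁ = + y
  embed (x , y , z) ₂ = + z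

  ·-≡mod : ∀ {N} A {u w : Vec³} → (∀ i → u i ≡ w i mod N) → ∀ i → (A · u) i ≡ (A · w) i mod N
  ·-≡mod A u≡w i = sum3-≡mod λ j → ≡mod-*ˡ (A i j) (u≡w j)

  ·-scale : ∀ s A v i → ((λ i j → s * A i j) · v) i ≡ s * (A · v) i
  ·-scale s A v i = trans (sum3-cong (λ j → ℤ.*-assoc s (A i j) (v j))) (sym (sum3-*ˡ s (λ j → A i j * v j)))

  module _ (N : ℕ) .{{_ : ℕ.NonZero N}} where

    reduce : Vec³ → ℕ³
    reduce u = u ₀ %ℕ N , u ₁ %ℕ N , u ₂ %ℕ N

    reduce-below : ∀ u → Below³ N (reduce u)
    reduce-below u = n%ℕd<d (u ₀) N , n%ℕd<d (u ₁) N , n%ℕd<d (u ₂) N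

    embed-reduce : ∀ u i → embed (reduce u) i ≡ u i mod N
    embed-reduce u ₀ = ≡mod-residue N (u ₀)
    embed-reduce u ₁ = ≡mod-residue N (u ₁)
    embed-reduce u ₂ = ≡mod-residue N (u ₂)

    reduce-unique : ∀ u p → Below³ N p → (∀ i → u i ≡ embed p i mod N) → reduce u ≡ p
    reduce-unique u (x , y , z) (x<N , y<N , z<N) u≡p =
      cong₂ _,_ (≡mod⇒%ℕ≡ x<N (u≡p ₀)) (cong₂ _,_ (≡mod⇒%ℕ≡ y<N (u≡p ₁)) (≡mod⇒%ℕ≡ z<N (u≡p ₂)))

    linear-map : Mat3 → ℕ³ → ℕ³
    linear-map A p = reduce (A · embed p)

    linear-map-inverse : ∀ A B s → s ≡ + 1 mod N → (∀ v i → (B · (A · v)) i ≡ s * v i) →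
      ∀ p → Below³ N p → linear-map B (linear-map A p) ≡ p
    linear-map-inverse A B s s≡1 BA≡s p p<N = reduce-unique _ p p<N λ i → begin
      (B · embed (linear-map A p)) i   ≈⟨ ·-≡mod B (embed-reduce (A · embed p)) i ⟩
      (B · (A · embed p)) i            ≡⟨ BA≡s (embed p) i ⟩
      s * embed p i                    ≈⟨ ≡mod-* s≡1 (≡mod-refl (embed p i)) ⟩
      + 1 * embed p i                  ≡⟨ ℤ.*-identityˡ (embed p i) ⟩
      embed p i                        ∎
      where open ≡mod-Reasoning N

  ·-cong : ∀ A {u w : Vec³} → (∀ i → u i ≡ w i) → ∀ i → (A · u) i ≡ (A · w) i
  ·-cong A u≡w i = sum3-cong λ j → cong (A i j *_) (u≡w j)

  ·-scaleᵥ : ∀ s A v i → (A · (λ j → s * v j)) i ≡ s * (A · v) i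
  ·-scaleᵥ s A v i = trans (sum3-cong (λ j → regroup (A i j) s (v j))) (sym (sum3-*ˡ s (λ j → A i j * v j)))
    where
    regroup : ∀ a s v → a * (s * v) ≡ s * (a * v)
    regroup = solve-∀

  count2-invariant : ∀ F G → Z2Equiv F G → ∀ n t → count2 F n t ≡ count2 G n t
  count2-invariant F G F≅G n t with F≅G (suc t)
  ... | M , det-odd , gram≡ with odd-invertible t {det3 M} (∤⇒Odd (det-odd ∘ ∣⇒∣ᵤ))
  ...   | w , det·w≡1 = sym (begin
    count2 G n t
      ≡⟨ sumBelow³-cong N (λ p _ → 𝟙-cong (≡mod-+ (≡mod-sym (gram-congruent-values t M gram≡ (embed p))) (≡mod-refl (- n)))) ⟩
    sumBelow³ N (λ p → 𝟙[ N ∣ evalᵥ F (M · embed p) - n ])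
      ≡⟨ sumBelow³-cong N (λ p _ → 𝟙-cong (≡mod-+ (≡mod-sym (eval-≡mod F (embed-reduce N (M · embed p)))) (≡mod-refl (- n)))) ⟩
    sumBelow³ N (λ p → 𝟙[ N ∣ evalᵥ F (embed (linear-map N M p)) - n ])
      ≡⟨ Reindex³.Sum-bijection N (linear-map N M) (linear-map N B)
           (λ p _ → reduce-below N (M · embed p)) (λ p _ → reduce-below N (B · embed p))
           (linear-map-inverse N M B s s≡1 BM≡s) (linear-map-inverse N B M s s≡1 MB≡s) (λ p → 𝟙[ N ∣ evalᵥ F (embed p) - n ]) ⟩
    count2 F n t ∎)
    where
    open ≡-Reasoning
    N = 2 ^ t
    instance
      N≢0 : ℕ.NonZero N
      N≢0 = ℕ.m^n≢0 2 t
    B : Mat3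
    B i j = w * adj M i j
    s = w * det3 M
    s≡1 : s ≡ + 1 mod N
    s≡1 = subst (λ a → a ≡ + 1 mod N) (ℤ.*-comm (det3 M) w) det·w≡1
    BM≡s : ∀ v i → (B · (M · v)) i ≡ s * v i
    BM≡s v i = trans (·-scale w (adj M) (M · v) i) (trans (cong (w *_) (adj-·-· M v i)) (sym (ℤ.*-assoc w (det3 M) (v i))))
    MB≡s : ∀ v i → (M · (B · v)) i ≡ s * v i
    MB≡s v i = trans (·-cong M (·-scale w (adj M) v) i)
      (trans (·-scaleᵥ w M (adj M · v) i) (trans (cong (w *_) (·-adj-· M v i)) (sym (ℤ.*-assoc w (det3 M) (v i)))))

open import Data.Nat as ℕ using (ℕ; zero; suc; _+_; _*_; _^_; _∸_; _≤_; _<_; _%_; _/_; s≤s)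
import Data.Nat.Properties as ℕ
open import Data.Nat.Divisibility using (_∣_; n∣m⇒m%n≡0)
open import Data.Nat.DivMod using (m≡m%n+[m/n]*n; %-distribˡ-+)
open import Data.Nat.Tactic.RingSolver using (solve-∀)
open import Data.Integer as ℤ using (+_)
import Data.Integer.Properties as ℤ
open import Data.Product using (_,_; _×_; ∃)
open import Relation.Nullary using (¬_)
open import Relation.Binary.PropositionalEquality
open TargetCount
open BaseCases
open Equivalence

open ≡-Reasoning

2^*2^ : ∀ s → 2 ^ s * 2 ^ s ≡ 4 ^ s
2^*2^ zero    = refl
2^*2^ (suc s) = trans (square-double (2 ^ s)) (cong (4 *_) (2^*2^ s))
  where
  square-double : ∀ P → (2 * P) * (2 * P) ≡ 4 * (P * P)
  square-double = solve-∀

-- count₄ m t = (3 - c / 2^a) · 4^t for t ≥ 2a + 3, with the subtraction moved across.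
record CountLaw (a m c : ℕ) : Set where
  constructor countLaw
  field
    holds : ∀ s → 2 * a ≤ s → count₄ (+ m) (3 + s) * 2 ^ a + c * 4 ^ (3 + s) ≡ 3 * 2 ^ a * 4 ^ (3 + s)

open CountLaw

CountLaw-4* : ∀ {a m c} → CountLaw a m c → CountLaw (suc a) (4 * m) c
CountLaw-4* {a} {m} {c} law = countLaw step
  where
  A = 2 ^ a
  factor-out : ∀ A X Y c → (96 * (4 * (4 * X)) + 8 * Y) * (2 * A) + c * (4 * (4 * (4 * (4 * (4 * X)))))
                          ≡ 3072 * (A * X) + 16 * (Y * A + c * (4 * (4 * (4 * X))))
  factor-out = solve-∀
  collect : ∀ A X → 3072 * (A * X) + 16 * (3 * A * (4 * (4 * (4 * X)))) ≡ 3 * (2 * A) * (4 * (4 * (4 * (4 * (4 * X)))))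
  collect = solve-∀
  step : ∀ s → 2 * suc a ≤ s → count₄ (+ (4 * m)) (3 + s) * 2 ^ suc a + c * 4 ^ (3 + s) ≡ 3 * 2 ^ suc a * 4 ^ (3 + s)
  step 0             ()
  step 1             (s≤s 2a+1≤0) with () ← subst (_≤ 0) (ℕ.+-suc a (a + 0)) 2a+1≤0
  step (suc (suc s)) 2a+2≤s+2 = begin
    count₄ (+ (4 * m)) (5 + s) * (2 * A) + c * 4 ^ (5 + s)
      ≡⟨ cong (λ Z → Z * (2 * A) + c * 4 ^ (5 + s))
           (trans (cong (λ m′ → count₄ m′ (5 + s)) (ℤ.pos-* 4 m)) (count₄-recursion (+ m) (2 + s))) ⟩
    (96 * (2 ^ (2 + s) * 2 ^ (2 + s)) + 8 * Y) * (2 * A) + c * (4 * (4 * (4 * (4 * (4 * X)))))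
      ≡⟨ cong (λ Z → (96 * Z + 8 * Y) * (2 * A) + c * (4 * (4 * (4 * (4 * (4 * X)))))) (2^*2^ (2 + s)) ⟩
    (96 * (4 * (4 * X)) + 8 * Y) * (2 * A) + c * (4 * (4 * (4 * (4 * (4 * X)))))
      ≡⟨ factor-out A X Y c ⟩
    3072 * (A * X) + 16 * (Y * A + c * (4 * (4 * (4 * X))))
      ≡⟨ cong (λ Z → 3072 * (A * X) + 16 * Z) (holds law s (ℕ.≤-pred (ℕ.≤-pred (subst (_≤ 2 + s) (ℕ.*-suc 2 a) 2a+2≤s+2)))) ⟩
    3072 * (A * X) + 16 * (3 * A * (4 * (4 * (4 * X))))
      ≡⟨ collect A X ⟩
    3 * (2 * A) * (4 * (4 * (4 * (4 * (4 * X))))) ∎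
    where
    X = 4 ^ s
    Y = count₄ (+ m) (3 + s)

CountLaw-4^ : ∀ a {k c} → CountLaw 0 k c → CountLaw a (4 ^ a * k) c
CountLaw-4^ zero    {k} {c} law = subst (λ m → CountLaw 0 m c) (sym (ℕ.*-identityˡ k)) law
CountLaw-4^ (suc a) {k} {c} law = subst (λ m → CountLaw (suc a) m c) (sym (ℕ.*-assoc 4 (4 ^ a) k)) (CountLaw-4* (CountLaw-4^ a law))

CountLaw-7-mod-8 : ∀ q → CountLaw 0 (7 + q * 8) 0
CountLaw-7-mod-8 q = countLaw λ s _ → begin
  count₄ (+ (7 + q * 8)) (3 + s) * 1 + 0 * 4 ^ (3 + s)  ≡⟨ cong (λ X → X * 1 + 0 * 4 ^ (3 + s)) (count₄-7-mod-8 q s) ⟩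
  192 * (2 ^ s * 2 ^ s) * 1 + 0 * 4 ^ (3 + s)           ≡⟨ cong (λ X → 192 * X * 1 + 0 * 4 ^ (3 + s)) (2^*2^ s) ⟩
  192 * 4 ^ s * 1 + 0 * (4 * (4 * (4 * 4 ^ s)))        ≡⟨ arithmetic (4 ^ s) ⟩
  3 * 1 * (4 * (4 * (4 * 4 ^ s)))                       ∎
  where
  arithmetic : ∀ X → 192 * X * 1 + 0 * (4 * (4 * (4 * X))) ≡ 3 * 1 * (4 * (4 * (4 * X)))
  arithmetic = solve-∀

CountLaw-3-mod-8 : ∀ q → CountLaw 0 (3 + q * 8) 2
CountLaw-3-mod-8 q = countLaw λ s _ → begin
  count₄ (+ (3 + q * 8)) (3 + s) * 1 + 2 * 4 ^ (3 + s)  ≡⟨ cong (λ X → X * 1 + 2 * 4 ^ (3 + s)) (count₄-3-mod-8 q s) ⟩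
  64 * (2 ^ s * 2 ^ s) * 1 + 2 * 4 ^ (3 + s)            ≡⟨ cong (λ X → 64 * X * 1 + 2 * 4 ^ (3 + s)) (2^*2^ s) ⟩
  64 * 4 ^ s * 1 + 2 * (4 * (4 * (4 * 4 ^ s)))         ≡⟨ arithmetic (4 ^ s) ⟩
  3 * 1 * (4 * (4 * (4 * 4 ^ s)))                       ∎
  where
  arithmetic : ∀ X → 64 * X * 1 + 2 * (4 * (4 * (4 * X))) ≡ 3 * 1 * (4 * (4 * (4 * X)))
  arithmetic = solve-∀

CountLaw-nonsquare : ∀ k → ¬ 4 ∣ k → ¬ 4 ∣ suc k → CountLaw 0 k 3
CountLaw-nonsquare k 4∤k 4∤k+1 = countLaw λ s _ →
  cong (λ X → X * 1 + 3 * 4 ^ (3 + s)) (count₄-nonsquare k (suc s) 4∤k 4∤k+1)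

4^≡2^2* : ∀ t → 4 ^ t ≡ 2 ^ (2 * t)
4^≡2^2* = ℕ.^-*-assoc 2 2

CountLaw⇒density : ∀ F → Z2Equiv F target → ∀ {a m c} → CountLaw a m c →
  Density2Is F (+ m) (3 * 2 ^ a ∸ c) (2 ^ a)
CountLaw⇒density F F≅target {a} {m} {c} law = 3 + 2 * a , λ t 3+2a≤t → density t (ℕ.m≤n⇒∃[o]m+o≡n 3+2a≤t)
  where
  density : ∀ t → ∃ (λ o → 3 + 2 * a + o ≡ t) → count2 F (+ m) t * 2 ^ a ≡ (3 * 2 ^ a ∸ c) * 2 ^ (2 * t)
  density .(3 + 2 * a + o) (o , refl) = begin
    count2 F (+ m) t * 2 ^ a                                ≡⟨ cong (_* 2 ^ a) (trans (count2-invariant F target F≅target (+ m) t) (count2-target (+ m) t)) ⟩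
    count₄ (+ m) t * 2 ^ a                                  ≡⟨ ℕ.m+n∸n≡m _ (c * 4 ^ t) ⟨
    count₄ (+ m) t * 2 ^ a + c * 4 ^ t ∸ c * 4 ^ t          ≡⟨ cong (_∸ c * 4 ^ t) (holds law (2 * a + o) (ℕ.m≤m+n (2 * a) o)) ⟩
    3 * 2 ^ a * 4 ^ t ∸ c * 4 ^ t                           ≡⟨ ℕ.*-distribʳ-∸ (4 ^ t) (3 * 2 ^ a) c ⟨
    (3 * 2 ^ a ∸ c) * 4 ^ t                                 ≡⟨ cong ((3 * 2 ^ a ∸ c) *_) (4^≡2^2* t) ⟩
    (3 * 2 ^ a ∸ c) * 2 ^ (2 * t)                           ∎
    where
    t = 3 + (2 * a + o)

Density2Is-cancel : ∀ {F n p} d .{{_ : ℕ.NonZero d}} → Density2Is F n (p * d) d → Density2Is F n p 1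
Density2Is-cancel {F} {n} {p} d (T , dens) = T , λ t T≤t → ℕ.*-cancelʳ-≡ (count2 F n t * 1) (p * 2 ^ (2 * t)) d (begin
  count2 F n t * 1 * d      ≡⟨ cong (_* d) (ℕ.*-identityʳ (count2 F n t)) ⟩
  count2 F n t * d          ≡⟨ dens t T≤t ⟩
  p * d * 2 ^ (2 * t)       ≡⟨ swap p d (2 ^ (2 * t)) ⟩
  p * 2 ^ (2 * t) * d       ∎)
  where
  swap : ∀ p d X → p * d * X ≡ p * X * d
  swap = solve-∀

4∤suc : ∀ {k r} → k % 4 ≡ r → ¬ (suc r % 4 ≡ 0) → ¬ 4 ∣ suc k
4∤suc {k} k%4≡r r+1≢0 4∣k+1 =
  r+1≢0 (trans (sym (trans (%-distribˡ-+ 1 k 4) (cong (λ x → (1 + x) % 4) k%4≡r))) (n∣m⇒m%n≡0 (suc k) 4 4∣k+1))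

theorem4p2 : (F : TernaryForm) → Z2Equiv F target →
    (n a k : ℕ) → 0 < n → n ≡ 4 ^ a * k → ¬ (4 ∣ k) →
    (k % 8 ≡ 7 → Density2Is F (+ n) 3 1)
    × (k % 8 ≡ 3 → Density2Is F (+ n) (3 * 2 ^ a ∸ 2) (2 ^ a))
    × ((k % 4 ≡ 1 → Density2Is F (+ n) (3 * 2 ^ a ∸ 3) (2 ^ a))
    × (k % 4 ≡ 2 → Density2Is F (+ n) (3 * 2 ^ a ∸ 3) (2 ^ a)))
theorem4p2 F F≅target .(4 ^ a * k) a k _ refl 4∤k =
    (λ k≡7 → Density2Is-cancel {F} {+ (4 ^ a * k)} {3} (2 ^ a) {{ℕ.m^n≢0 2 a}} (density (law-mod-8 k≡7 CountLaw-7-mod-8)))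
  , (λ k≡3 → density (law-mod-8 k≡3 CountLaw-3-mod-8))
  , (λ k≡1 → density (CountLaw-nonsquare k 4∤k (4∤suc k≡1 λ ())))
  , (λ k≡2 → density (CountLaw-nonsquare k 4∤k (4∤suc k≡2 λ ())))
  where
  density : ∀ {c} → CountLaw 0 k c → Density2Is F (+ (4 ^ a * k)) (3 * 2 ^ a ∸ c) (2 ^ a)
  density law = CountLaw⇒density F F≅target (CountLaw-4^ a law)
  law-mod-8 : ∀ {r c} → k % 8 ≡ r → (∀ q → CountLaw 0 (r + q * 8) c) → CountLaw 0 k c
  law-mod-8 {r} {c} k%8≡r law =
    subst (λ m → CountLaw 0 m c) (sym (trans (m≡m%n+[m/n]*n k 8) (cong (_+ k / 8 * 8) k%8≡r))) (law (k / 8))
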